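{- Let $n$ be odd and let $f$ be a semi-bent $n$-variable Boolean function. Then $|N_{\mathcal{A},2}(f)|=\frac{2^{2n-3}(2^{n-1}-1)}{3}$ and $\frac{|N_{\mathcal{A},2}(f)|}{|\mathcal{A}_{n,2}|}=\frac{2^{n-1}}{2^n-1}$.
   Context: A Boolean function $f\colon\mathbb{F}_2^n\to\mathbb{F}_2$ ($n$ odd) is semi-bent if all values of its Walsh transform $W_f(a)=\sum_{x\in\mathbb{F}_2^n}(-1)^{f(x)+\langle x,a\rangle}$, $a\in\mathbb{F}_2^n$, lie in $\{0,\pm 2^{(n+1)/2}\}$. $\mathcal{A}_{n,2}$ denotes the set of all $2$-flats of $\mathbb{F}_2^n$, i.e. sets $U+a$ with $U$ a $2$-dimensional linear subspace and $a\in\mathbb{F}_2^n$; $N_{\mathcal{A},2}(f)$ is the set of $A\in\mathcal{A}_{n,2}$ with $\sum_{x\in A}f(x)\neq 0$. -}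

module Defs where

open import Data.Bool using (Bool; true; false; _xor_; _∧_)
open import Data.Nat using (ℕ; suc; _*_)
open import Data.Integer as ℤ using (ℤ)
open import Data.Vec using (Vec; []; _∷_; zipWith; replicate; foldr)
open import Data.List as List using (List; []; _∷_; _++_; map; length)
open import Data.List.Relation.Unary.All using (All)
open import Data.List.Relation.Unary.Any using (Any)
open import Data.List.Relation.Unary.AllPairs using (AllPairs)
open import Data.Product using (Σ; _×_; ∃; ∃-syntax)
open import Relation.Binary.PropositionalEquality using (_≡_)
open import Relation.Nullary using (¬_)
open import Function using (_⇔_)

Odd : ℕ → Set
Odd n = Σ ℕ λ k → n ≡ suc (2 * k)

V : ℕ → Set
V n = Vec Bool n

0V : ∀ {n} → V n
0V = replicate _ false

infixl 6 _⊕_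
_⊕_ : ∀ {n} → V n → V n → V n
_⊕_ = zipWith _xor_

_·_ : ∀ {n} → Bool → V n → V n
c · x = Data.Vec.map (c ∧_) x

⟨_,_⟩ : ∀ {n} → V n → V n → Bool
⟨ x , a ⟩ = foldr _ _xor_ false (zipWith _∧_ x a)

allVecs : (n : ℕ) → List (V n)
allVecs ℕ.zero = [] ∷ []
allVecs (suc n) = map (false ∷_) (allVecs n) ++ map (true ∷_) (allVecs n)

BoolFun : ℕ → Set
BoolFun n = V n → Bool

sign : Bool → ℤ
sign false = ℤ.+ 1
sign true  = ℤ.- (ℤ.+ 1)

walsh : ∀ {n} → BoolFun n → V n → ℤ
walsh {n} f a = List.foldr ℤ._+_ (ℤ.+ 0) (map (λ x → sign (f x xor ⟨ x , a ⟩)) (allVecs n))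

SemiBent : (n : ℕ) → BoolFun n → Set
SemiBent n f = ∀ a → (walsh f a ≡ ℤ.+ 0)
                   Data.Sum.⊎ ((walsh f a ≡ ℤ.+ (2 Data.Nat.^ Data.Nat.⌊ suc n /2⌋))
                   Data.Sum.⊎ (walsh f a ≡ ℤ.- (ℤ.+ (2 Data.Nat.^ Data.Nat.⌊ suc n /2⌋))))
  where import Data.Sum

Subset : ℕ → Set
Subset n = V n → Bool

_∈S_ : ∀ {n} → V n → Subset n → Set
x ∈S A = A x ≡ true

_≐_ : ∀ {n} → Subset n → Subset n → Set
A ≐ B = ∀ x → A x ≡ B x

LinIndep2 : ∀ {n} → V n → V n → Set
LinIndep2 u v = ∀ (λ₁ λ₂ : Bool) → (λ₁ · u) ⊕ (λ₂ · v) ≡ 0V → (λ₁ ≡ false) × (λ₂ ≡ false)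

IsSubspace2 : ∀ {n} → Subset n → Set
IsSubspace2 {n} U = Σ (V n) λ u → Σ (V n) λ v → LinIndep2 u v ×
  (∀ x → x ∈S U ⇔ (∃[ λ₁ ] ∃[ λ₂ ] x ≡ (λ₁ · u) ⊕ (λ₂ · v)))

IsFlat2 : ∀ {n} → Subset n → Set
IsFlat2 {n} A = Σ (Subset n) λ U → Σ (V n) λ a → IsSubspace2 U ×
  (∀ x → x ∈S A ⇔ (Σ (V n) λ y → y ∈S U × x ≡ y ⊕ a))

sumOn : ∀ {n} → BoolFun n → Subset n → Bool
sumOn {n} f A = List.foldr _xor_ false (map (λ x → A x ∧ f x) (allVecs n))

InN2 : ∀ {n} → BoolFun n → Subset n → Set
InN2 f A = IsFlat2 A × sumOn f A ≡ true

-- the collection {A | P A} of subsets (P invariant under ≐) has exactly m elements: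
-- it is enumerated, up to extensional equality, by a duplicate-free list of length m
HasCard : ∀ {n} → (Subset n → Set) → ℕ → Set
HasCard {n} P m = Σ (List (Subset n)) λ L →
  (length L ≡ m) × All P L × (∀ A → P A → Any (A ≐_) L) × AllPairs (λ A B → ¬ (A ≐ B)) L

{-# OPTIONS --safe #-}
-- Write W for the Walsh transform of f and D²f(a; u, v) = f(a) + f(a+u) + f(a+v) + f(a+u+v) for the
-- sum of f over the flat a + ⟨u, v⟩. W(b)² is the Walsh transform of the autocorrelation
-- Δ(v) = Σ_x (-1)^{f(x)+f(x+v)}, and Δ(v)² = Σ_{a,u} (-1)^{D²f(a;u,v)}, so by Parseval
-- Σ_b W(b)⁴ = 2ⁿ Σ_{a,u,v} (-1)^{D²f(a;u,v)}. For semi-bent f every W(b)² is 0 or 2^{n+1}, hence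
-- Σ_b W(b)⁴ = 2^{n+1} Σ_b W(b)² = 2^{3n+1}, and D²f(a;u,v) = 1 for exactly 2^{3n-1} - 2^{2n} triples.
-- These triples all have u, v independent, and each 2-flat arises from exactly 4 · 3 · 2 = 24 triples
-- (a base point and an ordered basis of its direction), so |N_{A,2}(f)| = (2^{3n-1} - 2^{2n})/24;
-- counting all triples with u, v independent in the same way gives |A_{n,2}| = 2ⁿ(2ⁿ - 1)(2ⁿ - 2)/24.
module Submission where

open import Defs

open import Algebra.Bundles using (CommutativeMonoid; CommutativeRing)
open import Data.Bool as Bool using (Bool; true; false; not; _xor_; _∧_; _∨_; if_then_else_)
open import Data.Bool.Properties
  using (xor-∧-commutativeRing; xor-same; xor-comm; xor-assoc; xor-identityʳ; ∧-comm; ⇔→≡)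
open import Data.List as List using (List; []; _∷_; _++_)
import Data.List.Properties as Listₚ
open import Data.List.Membership.Propositional using (_∈_)
open import Data.List.Membership.Propositional.Properties
  using (∈-map⁺; ∈-++⁺ˡ; ∈-++⁺ʳ; ∈-filter⁺; ∈-cartesianProduct⁺)
open import Data.List.Membership.Setoid.Properties using () renaming (∈-filter⁺ to ∈ₛ-filter⁺)
open import Data.List.Relation.Unary.All as All using (All; []; _∷_)
import Data.List.Relation.Unary.All.Properties as Allₚ
open import Data.List.Relation.Unary.AllPairs using (AllPairs; []; _∷_)
import Data.List.Relation.Unary.AllPairs.Properties as AllPairsₚ
open import Data.List.Relation.Unary.Any as Any using (Any; here; there; any?)
import Data.List.Relation.Unary.Any.Properties as Anyₚ
open import Data.List.Relation.Unary.Unique.DecSetoid.Properties using (deduplicate-!)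
open import Data.List.Relation.Unary.Unique.Propositional using (Unique)
open import Data.Maybe using (Maybe; just; nothing)
open import Data.Nat as ℕ using (ℕ; zero; suc)
import Data.Nat.Properties as ℕₚ
open import Data.Nat.Tactic.RingSolver using () renaming (solve-∀ to ℕ-solve-∀)
open import Data.Product using (Σ; _×_; _,_; proj₁; proj₂; ∃-syntax)
open import Data.Sum using (_⊎_; inj₁; inj₂)
open import Data.Vec using (Vec; []; _∷_)
import Data.Vec.Properties as Vecₚ
open import Function using (_∘_; _⇔_; mk⇔; Equivalence)
import Function.Properties.Equivalence as ⇔
open import Level using (0ℓ)
open import Relation.Binary.Bundles using (DecSetoid; Setoid)
open import Relation.Binary.Definitions using (DecidableEquality)
import Relation.Binary.PropositionalEquality as ≡
open import Relation.Binary.PropositionalEquality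
  using (_≡_; _≢_; refl; sym; trans; cong; cong₂; subst; subst₂; module ≡-Reasoning)
open import Relation.Nullary using (Dec; yes; no; does; ¬_; ¬?; _×-dec_; contradiction)
open import Relation.Nullary.Decidable using (dec-false; does-⇔)
open import Tactic.RingSolver using (solve-∀)
open import Tactic.RingSolver.Core.AlmostCommutativeRing using (AlmostCommutativeRing; fromCommutativeRing)

𝔽₂ : AlmostCommutativeRing 0ℓ 0ℓ
𝔽₂ = fromCommutativeRing xor-∧-commutativeRing false≟
  where
  false≟ : ∀ b → Maybe (false ≡ b)
  false≟ false = just refl
  false≟ true  = nothing

variable
  n : ℕ

does≡true⇔ : ∀ {A : Set} (a? : Dec A) → does a? ≡ true ⇔ A
does≡true⇔ (yes a) = mk⇔ (λ _ → a) (λ _ → refl)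
does≡true⇔ (no ¬a) = mk⇔ (λ ()) (λ a → contradiction a ¬a)

∧≡true⇔ : ∀ {a b} → a ∧ b ≡ true ⇔ (a ≡ true × b ≡ true)
∧≡true⇔ {false} = mk⇔ (λ ()) (λ ())
∧≡true⇔ {true}  = mk⇔ (refl ,_) proj₂

not-does≡true⇔ : ∀ {A : Set} (a? : Dec A) → not (does a?) ≡ true ⇔ (¬ A)
not-does≡true⇔ (yes a) = mk⇔ (λ ()) (λ ¬a → contradiction a ¬a)
not-does≡true⇔ (no ¬a) = mk⇔ (λ _ → ¬a) (λ _ → refl)

∧≡if : ∀ b c → b ∧ c ≡ (if b then c else false)
∧≡if false c = refl
∧≡if true  c = refl

⊕-comm : (x y : V n) → x ⊕ y ≡ y ⊕ x
⊕-comm []      []      = refl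
⊕-comm (a ∷ x) (b ∷ y) = cong₂ _∷_ (xor-comm a b) (⊕-comm x y)

⊕-assoc : (x y z : V n) → (x ⊕ y) ⊕ z ≡ x ⊕ (y ⊕ z)
⊕-assoc []      []      []      = refl
⊕-assoc (a ∷ x) (b ∷ y) (c ∷ z) = cong₂ _∷_ (xor-assoc a b c) (⊕-assoc x y z)

⊕-identityˡ : (x : V n) → 0V ⊕ x ≡ x
⊕-identityˡ []      = refl
⊕-identityˡ (a ∷ x) = cong (a ∷_) (⊕-identityˡ x)

⊕-identityʳ : (x : V n) → x ⊕ 0V ≡ x
⊕-identityʳ x = trans (⊕-comm x 0V) (⊕-identityˡ x)

⊕-same : (x : V n) → x ⊕ x ≡ 0V
⊕-same []      = refl
⊕-same (a ∷ x) = cong₂ _∷_ (xor-same a) (⊕-same x)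

⊕-cancelˡ : (x y : V n) → x ⊕ (x ⊕ y) ≡ y
⊕-cancelˡ x y = begin
  x ⊕ (x ⊕ y)  ≡⟨ ⊕-assoc x x y ⟨
  (x ⊕ x) ⊕ y  ≡⟨ cong (_⊕ y) (⊕-same x) ⟩
  0V ⊕ y       ≡⟨ ⊕-identityˡ y ⟩
  y            ∎
  where open ≡-Reasoning

⊕-cancelʳ : (x y : V n) → (y ⊕ x) ⊕ x ≡ y
⊕-cancelʳ x y = trans (⊕-assoc y x x) (trans (cong (y ⊕_) (⊕-same x)) (⊕-identityʳ y))

⊕≡0⇒≡ : {x y : V n} → x ⊕ y ≡ 0V → x ≡ y
⊕≡0⇒≡ {x = x} {y} e = trans (sym (⊕-identityʳ x)) (trans (cong (x ⊕_) (sym e)) (⊕-cancelˡ x y))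

⊕≡0⇔≡ : (x y : V n) → x ⊕ y ≡ 0V ⇔ y ≡ x
⊕≡0⇔≡ x y = mk⇔ (sym ∘ ⊕≡0⇒≡) (λ { refl → ⊕-same x })

·-identityˡ : (x : V n) → true · x ≡ x
·-identityˡ []      = refl
·-identityˡ (a ∷ x) = cong (a ∷_) (·-identityˡ x)

·-zeroˡ : (x : V n) → false · x ≡ 0V
·-zeroˡ []      = refl
·-zeroˡ (a ∷ x) = cong (false ∷_) (·-zeroˡ x)

module _ (u v : V n) where

  lincomb-ff : false · u ⊕ false · v ≡ 0V
  lincomb-ff = trans (cong₂ _⊕_ (·-zeroˡ u) (·-zeroˡ v)) (⊕-identityˡ 0V)

  lincomb-tf : true · u ⊕ false · v ≡ u
  lincomb-tf = trans (cong₂ _⊕_ (·-identityˡ u) (·-zeroˡ v)) (⊕-identityʳ u)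

  lincomb-ft : false · u ⊕ true · v ≡ v
  lincomb-ft = trans (cong₂ _⊕_ (·-zeroˡ u) (·-identityˡ v)) (⊕-identityˡ v)

  lincomb-tt : true · u ⊕ true · v ≡ u ⊕ v
  lincomb-tt = cong₂ _⊕_ (·-identityˡ u) (·-identityˡ v)

lincomb-⊕ : (u v : V n) (l₁ l₂ m₁ m₂ : Bool) →
  (l₁ · u ⊕ l₂ · v) ⊕ (m₁ · u ⊕ m₂ · v) ≡ (l₁ xor m₁) · u ⊕ (l₂ xor m₂) · v
lincomb-⊕ []      []      l₁ l₂ m₁ m₂ = refl
lincomb-⊕ (a ∷ u) (b ∷ v) l₁ l₂ m₁ m₂ = cong₂ _∷_ (coordinate l₁ l₂ m₁ m₂ a b) (lincomb-⊕ u v l₁ l₂ m₁ m₂)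
  where
  coordinate : ∀ l₁ l₂ m₁ m₂ a b →
    ((l₁ ∧ a) xor (l₂ ∧ b)) xor ((m₁ ∧ a) xor (m₂ ∧ b)) ≡ ((l₁ xor m₁) ∧ a) xor ((l₂ xor m₂) ∧ b)
  coordinate = solve-∀ 𝔽₂

lincomb-lincomb : (u v : V n) (c₁ c₂ α₁ α₂ β₁ β₂ : Bool) →
  c₁ · (α₁ · u ⊕ α₂ · v) ⊕ c₂ · (β₁ · u ⊕ β₂ · v)
    ≡ ((c₁ ∧ α₁) xor (c₂ ∧ β₁)) · u ⊕ ((c₁ ∧ α₂) xor (c₂ ∧ β₂)) · v
lincomb-lincomb []      []      c₁ c₂ α₁ α₂ β₁ β₂ = refl
lincomb-lincomb (a ∷ u) (b ∷ v) c₁ c₂ α₁ α₂ β₁ β₂ =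
  cong₂ _∷_ (coordinate c₁ c₂ α₁ α₂ β₁ β₂ a b) (lincomb-lincomb u v c₁ c₂ α₁ α₂ β₁ β₂)
  where
  coordinate : ∀ c₁ c₂ α₁ α₂ β₁ β₂ a b →
    (c₁ ∧ ((α₁ ∧ a) xor (α₂ ∧ b))) xor (c₂ ∧ ((β₁ ∧ a) xor (β₂ ∧ b)))
      ≡ (((c₁ ∧ α₁) xor (c₂ ∧ β₁)) ∧ a) xor (((c₁ ∧ α₂) xor (c₂ ∧ β₂)) ∧ b)
  coordinate = solve-∀ 𝔽₂

⟨⟩-⊕ˡ : (x y b : V n) → ⟨ x ⊕ y , b ⟩ ≡ ⟨ x , b ⟩ xor ⟨ y , b ⟩
⟨⟩-⊕ˡ []      []      []      = refl
⟨⟩-⊕ˡ (x ∷ xs) (y ∷ ys) (b ∷ bs) =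
  trans (cong (((x xor y) ∧ b) xor_) (⟨⟩-⊕ˡ xs ys bs)) (coordinate x y b ⟨ xs , bs ⟩ ⟨ ys , bs ⟩)
  where
  coordinate : ∀ x y b X Y → ((x xor y) ∧ b) xor (X xor Y) ≡ ((x ∧ b) xor X) xor ((y ∧ b) xor Y)
  coordinate = solve-∀ 𝔽₂

infix 4 _≟_
_≟_ : DecidableEquality (V n)
_≟_ = Vecₚ.≡-dec Bool._≟_

LinIndep2⇔ : (u v : V n) → LinIndep2 u v ⇔ (u ≢ 0V × v ≢ 0V × u ≢ v)
LinIndep2⇔ u v = mk⇔ necessary sufficient
  where
  necessary : LinIndep2 u v → u ≢ 0V × v ≢ 0V × u ≢ v
  necessary li = (λ u≡0 → true≢false (proj₁ (li true false (trans (lincomb-tf u v) u≡0))))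
               , (λ v≡0 → true≢false (proj₂ (li false true (trans (lincomb-ft u v) v≡0))))
               , (λ u≡v → true≢false (proj₁ (li true true (trans (lincomb-tt u v) (trans (cong (u ⊕_) (sym u≡v)) (⊕-same u))))))
    where
    true≢false : true ≢ false
    true≢false ()
  sufficient : u ≢ 0V × v ≢ 0V × u ≢ v → LinIndep2 u v
  sufficient _                  false false _ = refl , refl
  sufficient (u≢0 , _ , _)      true  false e = contradiction (trans (sym (lincomb-tf u v)) e) u≢0
  sufficient (_ , v≢0 , _)      false true  e = contradiction (trans (sym (lincomb-ft u v)) e) v≢0
  sufficient (_ , _ , u≢v)      true  true  e = contradiction (⊕≡0⇒≡ (trans (sym (lincomb-tt u v)) e)) u≢v

-- Defined by `with` rather than Dec.map so that `does (independent? u v)` does not unfold and can be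
-- abstracted by `with independent? u v`.
independent? : (u v : V n) → Dec (LinIndep2 u v)
independent? u v with ¬? (u ≟ 0V) ×-dec ¬? (v ≟ 0V) ×-dec ¬? (u ≟ v)
... | yes nondegenerate = yes (Equivalence.from (LinIndep2⇔ u v) nondegenerate)
... | no  degenerate    = no (degenerate ∘ Equivalence.to (LinIndep2⇔ u v))

does-independent? : (u v : V n) →
  does (independent? u v) ≡ not (does (u ≟ 0V)) ∧ not (does (v ≟ 0V)) ∧ not (does (u ≟ v))
does-independent? u v = does-⇔ (LinIndep2⇔ u v) (independent? u v) (¬? (u ≟ 0V) ×-dec ¬? (v ≟ 0V) ×-dec ¬? (u ≟ v))

spanPoints : V n → V n → List (V n)
spanPoints u v = 0V ∷ u ∷ v ∷ u ⊕ v ∷ []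

span : V n → V n → Subset n
span u v y = does (any? (y ≟_) (spanPoints u v))

∈-span⇔ : (u v y : V n) → y ∈S span u v ⇔ (∃[ l₁ ] ∃[ l₂ ] y ≡ l₁ · u ⊕ l₂ · v)
∈-span⇔ u v y = ⇔.trans (does≡true⇔ (any? (y ≟_) (spanPoints u v))) (mk⇔ to from)
  where
  to : y ∈ spanPoints u v → ∃[ l₁ ] ∃[ l₂ ] y ≡ l₁ · u ⊕ l₂ · v
  to (here e)                        = false , false , trans e (sym (lincomb-ff u v))
  to (there (here e))                = true  , false , trans e (sym (lincomb-tf u v))
  to (there (there (here e)))        = false , true  , trans e (sym (lincomb-ft u v))
  to (there (there (there (here e)))) = true  , true  , trans e (sym (lincomb-tt u v))
  from : ∃[ l₁ ] ∃[ l₂ ] y ≡ l₁ · u ⊕ l₂ · v → y ∈ spanPoints u v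
  from (false , false , e) = here (trans e (lincomb-ff u v))
  from (true  , false , e) = there (here (trans e (lincomb-tf u v)))
  from (false , true  , e) = there (there (here (trans e (lincomb-ft u v))))
  from (true  , true  , e) = there (there (there (here (trans e (lincomb-tt u v)))))

span-lincomb : (u v : V n) (l₁ l₂ : Bool) → (l₁ · u ⊕ l₂ · v) ∈S span u v
span-lincomb u v l₁ l₂ = Equivalence.from (∈-span⇔ u v _) (l₁ , l₂ , refl)

module _ (u v : V n) where

  span-⊕ : {y y′ : V n} → y ∈S span u v → y′ ∈S span u v → (y ⊕ y′) ∈S span u v
  span-⊕ {y} {y′} y∈ y′∈ with Equivalence.to (∈-span⇔ u v y) y∈ | Equivalence.to (∈-span⇔ u v y′) y′∈
  ... | l₁ , l₂ , refl | m₁ , m₂ , refl = subst (_∈S span u v) (sym (lincomb-⊕ u v l₁ l₂ m₁ m₂)) (span-lincomb u v _ _)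

  0∈span : 0V ∈S span u v
  0∈span = subst (_∈S span u v) (lincomb-ff u v) (span-lincomb u v false false)

  u∈span : u ∈S span u v
  u∈span = subst (_∈S span u v) (lincomb-tf u v) (span-lincomb u v true false)

  v∈span : v ∈S span u v
  v∈span = subst (_∈S span u v) (lincomb-ft u v) (span-lincomb u v false true)

span-minimal : {u v u₀ v₀ : V n} → u ∈S span u₀ v₀ → v ∈S span u₀ v₀ →
  ∀ y → y ∈S span u v → y ∈S span u₀ v₀
span-minimal {u = u} {v} {u₀} {v₀} u∈ v∈ y y∈
  with Equivalence.to (∈-span⇔ u v y) y∈ | Equivalence.to (∈-span⇔ u₀ v₀ u) u∈ | Equivalence.to (∈-span⇔ u₀ v₀ v) v∈
... | l₁ , l₂ , refl | α₁ , α₂ , refl | β₁ , β₂ , refl =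
  subst (_∈S span u₀ v₀) (sym (lincomb-lincomb u₀ v₀ l₁ l₂ α₁ α₂ β₁ β₂)) (span-lincomb u₀ v₀ _ _)

-- Cramer's rule over 𝔽₂: the adjugate of the coefficient matrix inverts it up to the determinant.
adjugate : (u₀ v₀ : V n) (α₁ α₂ β₁ β₂ : Bool) →
  let u = α₁ · u₀ ⊕ α₂ · v₀; v = β₁ · u₀ ⊕ β₂ · v₀; δ = (α₁ ∧ β₂) xor (α₂ ∧ β₁) in
  (β₂ · u ⊕ α₂ · v ≡ δ · u₀ ⊕ false · v₀) × (β₁ · u ⊕ α₁ · v ≡ false · u₀ ⊕ δ · v₀)
adjugate u₀ v₀ α₁ α₂ β₁ β₂ =
    trans (lincomb-lincomb u₀ v₀ β₂ α₂ α₁ α₂ β₁ β₂)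
          (cong₂ (λ s t → s · u₀ ⊕ t · v₀) (cong (_xor (α₂ ∧ β₁)) (∧-comm β₂ α₁)) (cancel β₂ α₂))
  , trans (lincomb-lincomb u₀ v₀ β₁ α₁ α₁ α₂ β₁ β₂)
          (cong₂ (λ s t → s · u₀ ⊕ t · v₀) (cancel β₁ α₁)
                 (trans (xor-comm (β₁ ∧ α₂) (α₁ ∧ β₂)) (cong ((α₁ ∧ β₂) xor_) (∧-comm β₁ α₂))))
  where
  cancel : ∀ a b → (a ∧ b) xor (b ∧ a) ≡ false
  cancel a b = trans (cong ((a ∧ b) xor_) (∧-comm b a)) (xor-same (a ∧ b))

basis-in-span : {u v u₀ v₀ : V n} → LinIndep2 u v → u ∈S span u₀ v₀ → v ∈S span u₀ v₀ →
  u₀ ∈S span u v × v₀ ∈S span u v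
basis-in-span {u = u} {v} {u₀} {v₀} li u∈ v∈
  with Equivalence.to (∈-span⇔ u₀ v₀ u) u∈ | Equivalence.to (∈-span⇔ u₀ v₀ v) v∈
... | α₁ , α₂ , refl | β₁ , β₂ , refl with (α₁ ∧ β₂) xor (α₂ ∧ β₁) | adjugate u₀ v₀ α₁ α₂ β₁ β₂
... | true | e₁ , e₂ =
    subst (_∈S span u v) (trans e₁ (lincomb-tf u₀ v₀)) (span-lincomb u v β₂ α₂)
  , subst (_∈S span u v) (trans e₂ (lincomb-ft u₀ v₀)) (span-lincomb u v β₁ α₁)
... | false | e₁ , e₂ with li β₂ α₂ (trans e₁ (lincomb-ff u₀ v₀)) | li β₁ α₁ (trans e₂ (lincomb-ff u₀ v₀))
... | refl , refl | refl , refl = contradiction (lincomb-ff u₀ v₀) (proj₁ (Equivalence.to (LinIndep2⇔ u v) li))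

span-≐ : {u v u₀ v₀ : V n} → LinIndep2 u v → u ∈S span u₀ v₀ → v ∈S span u₀ v₀ → span u v ≐ span u₀ v₀
span-≐ li u∈ v∈ y = ⇔→≡ (mk⇔ (span-minimal u∈ v∈ y) (span-minimal u₀∈ v₀∈ y))
  where
  u₀∈ = proj₁ (basis-in-span li u∈ v∈)
  v₀∈ = proj₂ (basis-in-span li u∈ v∈)

spanPoints-unique : {u v : V n} → LinIndep2 u v → Unique (spanPoints u v)
spanPoints-unique {u = u} {v} li with Equivalence.to (LinIndep2⇔ u v) li
... | u≢0 , v≢0 , u≢v =
    (u≢0 ∘ sym ∷ v≢0 ∘ sym ∷ (λ e → u≢v (⊕≡0⇒≡ (sym e))) ∷ [])
  ∷ (u≢v ∷ (λ e → v≢0 (trans (sym (⊕-cancelˡ u v)) (trans (cong (u ⊕_) (sym e)) (⊕-same u)))) ∷ [])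
  ∷ ((λ e → u≢0 (trans (sym (⊕-cancelʳ v u)) (trans (cong (_⊕ v) (sym e)) (⊕-same v)))) ∷ [])
  ∷ [] ∷ []

flat : V n → V n → V n → Subset n
flat a u v x = span u v (x ⊕ a)

flat-isFlat2 : (a : V n) {u v : V n} → LinIndep2 u v → IsFlat2 (flat a u v)
flat-isFlat2 a {u} {v} li = span u v , a , (u , v , li , ∈-span⇔ u v) , λ x → mk⇔ (to x) (from x)
  where
  to : ∀ x → x ∈S flat a u v → Σ (V _) λ y → y ∈S span u v × x ≡ y ⊕ a
  to x x∈ = x ⊕ a , x∈ , sym (⊕-cancelʳ a x)
  from : ∀ x → (Σ (V _) λ y → y ∈S span u v × x ≡ y ⊕ a) → x ∈S flat a u v
  from x (y , y∈ , refl) = subst (_∈S span u v) (sym (⊕-cancelʳ a y)) y∈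

IsFlat2⇒flat : {A : Subset n} → IsFlat2 A → Σ (V n) λ a → Σ (V n) λ u → Σ (V n) λ v → LinIndep2 u v × A ≐ flat a u v
IsFlat2⇒flat {A = A} (U , a , (u , v , li , U⇔) , A⇔) = a , u , v , li , λ x → ⇔→≡ (mk⇔ (to x) (from x))
  where
  U≐span : U ≐ span u v
  U≐span y = ⇔→≡ (⇔.trans (U⇔ y) (⇔.sym (∈-span⇔ u v y)))
  to : ∀ x → x ∈S A → x ∈S flat a u v
  to x x∈ with Equivalence.to (A⇔ x) x∈
  ... | y , y∈U , refl = subst (_∈S span u v) (sym (⊕-cancelʳ a y)) (trans (sym (U≐span y)) y∈U)
  from : ∀ x → x ∈S flat a u v → x ∈S A
  from x x∈ = Equivalence.from (A⇔ x) (x ⊕ a , trans (U≐span (x ⊕ a)) x∈ , sym (⊕-cancelʳ a x))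

span-translate : {u v c : V n} → c ∈S span u v → (y : V n) → span u v (y ⊕ c) ≡ span u v y
span-translate {u = u} {v} {c} c∈ y =
  ⇔→≡ (mk⇔ (λ y⊕c∈ → subst (_∈S span u v) (⊕-cancelʳ c y) (span-⊕ u v {y ⊕ c} y⊕c∈ c∈))
            (λ y∈ → span-⊕ u v {y} y∈ c∈))

flat≐flat⇔ : (a : V n) {u₀ v₀ x u v : V n} → LinIndep2 u v →
  flat x u v ≐ flat a u₀ v₀ ⇔ (x ∈S flat a u₀ v₀ × u ∈S span u₀ v₀ × v ∈S span u₀ v₀)
flat≐flat⇔ a {u₀} {v₀} {x} {u} {v} li = mk⇔ necessary sufficient
  where
  necessary : flat x u v ≐ flat a u₀ v₀ → x ∈S flat a u₀ v₀ × u ∈S span u₀ v₀ × v ∈S span u₀ v₀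
  necessary e = x∈F , direction u (u∈span u v) , direction v (v∈span u v)
    where
    x∈F : x ∈S flat a u₀ v₀
    x∈F = trans (sym (e x)) (subst (_∈S span u v) (sym (⊕-same x)) (0∈span u v))
    direction : (w : V _) → w ∈S span u v → w ∈S span u₀ v₀
    direction w w∈ = trans (sym (span-translate x∈F w)) (subst (_∈S span u₀ v₀) (⊕-assoc w x a)
      (trans (sym (e (w ⊕ x))) (subst (_∈S span u v) (sym (⊕-cancelʳ x w)) w∈)))
  sufficient : x ∈S flat a u₀ v₀ × u ∈S span u₀ v₀ × v ∈S span u₀ v₀ → flat x u v ≐ flat a u₀ v₀
  sufficient (x∈F , u∈ , v∈) y = begin
    span u v (y ⊕ x)                  ≡⟨ span-≐ li u∈ v∈ (y ⊕ x) ⟩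
    span u₀ v₀ (y ⊕ x)                ≡⟨ span-translate x∈F (y ⊕ x) ⟨
    span u₀ v₀ ((y ⊕ x) ⊕ (x ⊕ a))    ≡⟨ cong (span u₀ v₀) (trans (⊕-assoc y x (x ⊕ a)) (cong (y ⊕_) (⊕-cancelˡ x a))) ⟩
    span u₀ v₀ (y ⊕ a)                ∎
    where open ≡-Reasoning

allVecs-complete : (x : V n) → x ∈ allVecs n
allVecs-complete []          = here refl
allVecs-complete (false ∷ x) = ∈-++⁺ˡ (∈-map⁺ (false ∷_) (allVecs-complete x))
allVecs-complete (true ∷ x)  = ∈-++⁺ʳ (List.map (false ∷_) (allVecs _)) (∈-map⁺ (true ∷_) (allVecs-complete x))

infix 4 _≐?_
-- Defined by `with` for the same reason as independent?.
_≐?_ : (A B : Subset n) → Dec (A ≐ B)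
_≐?_ {n} A B with All.all? (λ x → A x Bool.≟ B x) (allVecs n)
... | yes A≗B = yes (λ x → All.lookup A≗B (allVecs-complete x))
... | no  A≉B = no (λ A≐B → A≉B (All.tabulate (λ {x} _ → A≐B x)))

≐-decSetoid : ℕ → DecSetoid 0ℓ 0ℓ
≐-decSetoid n = record
  { Carrier          = Subset n
  ; _≈_              = _≐_
  ; isDecEquivalence = record
    { isEquivalence = record
      { refl  = λ _ → refl
      ; sym   = λ A≐B x → sym (A≐B x)
      ; trans = λ A≐B B≐C x → trans (A≐B x) (B≐C x)
      }
    ; _≟_ = _≐?_
    }
  }

≐-setoid : ℕ → Setoid 0ℓ 0ℓ
≐-setoid n = DecSetoid.setoid (≐-decSetoid n)

module _ {n : ℕ} where
  open DecSetoid (≐-decSetoid n) public using () renaming (sym to ≐-sym; trans to ≐-trans)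

Triple : ℕ → Set
Triple n = V n × V n × V n

triples : ∀ n → List (Triple n)
triples n = List.cartesianProduct (allVecs n) (List.cartesianProduct (allVecs n) (allVecs n))

Independent : Triple n → Set
Independent (x , u , v) = LinIndep2 u v

independent-triple? : (t : Triple n) → Dec (Independent t)
independent-triple? (x , u , v) = independent? u v

flatOf : Triple n → Subset n
flatOf (x , u , v) = flat x u v

flatList : ∀ n → List (Subset n)
flatList n = List.map flatOf (List.filter independent-triple? (triples n))

flats : ∀ n → List (Subset n)
flats n = List.deduplicate _≐?_ (flatList n)

flats-isFlat2 : ∀ n → All IsFlat2 (flats n)
flats-isFlat2 n = Allₚ.deduplicate⁺ _≐?_ (Allₚ.map⁺ (All.map flatOf-isFlat2 (Allₚ.all-filter independent-triple? (triples n))))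
  where
  flatOf-isFlat2 : {t : Triple n} → Independent t → IsFlat2 (flatOf t)
  flatOf-isFlat2 {x , u , v} = flat-isFlat2 x

flats-unique : ∀ n → AllPairs (λ A B → ¬ A ≐ B) (flats n)
flats-unique n = deduplicate-! (≐-decSetoid n) (flatList n)

flats-complete : {A : Subset n} → IsFlat2 A → Any (A ≐_) (flats n)
flats-complete {n} {A} A-flat with IsFlat2⇒flat A-flat
... | a , u , v , li , A≐flat =
  Anyₚ.deduplicate⁺ _≐?_ (λ C≐B A≐C → ≐-trans A≐C (≐-sym C≐B))
    (Any.map (λ { refl → A≐flat }) (∈-map⁺ flatOf (∈-filter⁺ independent-triple? t∈triples li)))
  where
  t∈triples : (a , u , v) ∈ triples n
  t∈triples = ∈-cartesianProduct⁺ (allVecs-complete a) (∈-cartesianProduct⁺ (allVecs-complete u) (allVecs-complete v))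

flats-hasCard : ∀ n → HasCard (IsFlat2 {n}) (List.length (flats n))
flats-hasCard n = flats n , refl , flats-isFlat2 n , (λ _ → flats-complete) , flats-unique n

module Sum (M : CommutativeMonoid 0ℓ 0ℓ) where
  open CommutativeMonoid M renaming (Carrier to C; refl to ≈-refl; sym to ≈-sym; trans to ≈-trans)
  open import Algebra.Properties.CommutativeSemigroup commutativeSemigroup using (interchange)
  open import Relation.Binary.Reasoning.Setoid setoid

  -- The fold used by walsh and sumOn, which are therefore ∑ over ℤ and over 𝔽₂ by definition.
  ∑ˡ : {A : Set} → List A → (A → C) → C
  ∑ˡ xs g = List.foldr _∙_ ε (List.map g xs)

  ∑ : (n : ℕ) → (V n → C) → C
  ∑ n = ∑ˡ (allVecs n)

  module _ {A : Set} where

    ∑ˡ-cong : {g h : A → C} (xs : List A) → All (λ x → g x ≈ h x) xs → ∑ˡ xs g ≈ ∑ˡ xs h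
    ∑ˡ-cong []       []       = ≈-refl
    ∑ˡ-cong (x ∷ xs) (e ∷ es) = ∙-cong e (∑ˡ-cong xs es)

    ∑ˡ-++ : (g : A → C) (xs ys : List A) → ∑ˡ (xs ++ ys) g ≈ ∑ˡ xs g ∙ ∑ˡ ys g
    ∑ˡ-++ g []       ys = ≈-sym (identityˡ _)
    ∑ˡ-++ g (x ∷ xs) ys = ≈-trans (∙-congˡ (∑ˡ-++ g xs ys)) (≈-sym (assoc _ _ _))

    ∑ˡ-∙ : (g h : A → C) (xs : List A) → ∑ˡ xs (λ x → g x ∙ h x) ≈ ∑ˡ xs g ∙ ∑ˡ xs h
    ∑ˡ-∙ g h []       = ≈-sym (identityˡ ε)
    ∑ˡ-∙ g h (x ∷ xs) = ≈-trans (∙-congˡ (∑ˡ-∙ g h xs)) (interchange _ _ _ _)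

    ∑ˡ-ε : (xs : List A) → ∑ˡ xs (λ _ → ε) ≈ ε
    ∑ˡ-ε []       = ≈-refl
    ∑ˡ-ε (x ∷ xs) = ≈-trans (identityˡ _) (∑ˡ-ε xs)

  ∑ˡ-map : {A B : Set} (f : A → B) (g : B → C) (xs : List A) → ∑ˡ (List.map f xs) g ≡ ∑ˡ xs (g ∘ f)
  ∑ˡ-map f g xs = ≡.cong (List.foldr _∙_ ε) (≡.sym (Listₚ.map-∘ xs))

  ∑ˡ-comm : {A B : Set} (h : A → B → C) (xs : List A) (ys : List B) →
    ∑ˡ xs (λ x → ∑ˡ ys (h x)) ≈ ∑ˡ ys (λ y → ∑ˡ xs (λ x → h x y))
  ∑ˡ-comm h []       ys = ≈-sym (∑ˡ-ε ys)
  ∑ˡ-comm h (x ∷ xs) ys = ≈-trans (∙-congˡ (∑ˡ-comm h xs ys)) (≈-sym (∑ˡ-∙ (h x) _ ys))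

  ∑-cong : ∀ n {g h : V n → C} → (∀ x → g x ≈ h x) → ∑ n g ≈ ∑ n h
  ∑-cong n e = ∑ˡ-cong (allVecs n) (All.tabulate (λ {x} _ → e x))

  ∑-suc : ∀ n (g : V (suc n) → C) → ∑ (suc n) g ≈ ∑ n (g ∘ (false ∷_)) ∙ ∑ n (g ∘ (true ∷_))
  ∑-suc n g = begin
    ∑ˡ (List.map (false ∷_) (allVecs n) ++ List.map (true ∷_) (allVecs n)) g
      ≈⟨ ∑ˡ-++ g (List.map (false ∷_) (allVecs n)) _ ⟩
    ∑ˡ (List.map (false ∷_) (allVecs n)) g ∙ ∑ˡ (List.map (true ∷_) (allVecs n)) g
      ≡⟨ ≡.cong₂ _∙_ (∑ˡ-map _ g (allVecs n)) (∑ˡ-map _ g (allVecs n)) ⟩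
    ∑ n (g ∘ (false ∷_)) ∙ ∑ n (g ∘ (true ∷_)) ∎

  ∑-translate : ∀ n (g : V n → C) (c : V n) → ∑ n (λ x → g (x ⊕ c)) ≈ ∑ n g
  ∑-translate zero    g []      = ≈-refl
  ∑-translate (suc n) g (b ∷ c) = begin
    ∑ (suc n) (λ x → g (x ⊕ (b ∷ c)))
      ≈⟨ ∑-suc n _ ⟩
    ∑ n (λ x → g ((false xor b) ∷ x ⊕ c)) ∙ ∑ n (λ x → g ((true xor b) ∷ x ⊕ c))
      ≈⟨ ∙-cong (∑-translate n _ c) (∑-translate n _ c) ⟩
    ∑ n (g ∘ ((false xor b) ∷_)) ∙ ∑ n (g ∘ ((true xor b) ∷_))
      ≈⟨ halves b ⟩
    ∑ n (g ∘ (false ∷_)) ∙ ∑ n (g ∘ (true ∷_))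
      ≈⟨ ∑-suc n g ⟨
    ∑ (suc n) g ∎
    where
    halves : ∀ b → ∑ n (g ∘ ((false xor b) ∷_)) ∙ ∑ n (g ∘ ((true xor b) ∷_))
                 ≈ ∑ n (g ∘ (false ∷_)) ∙ ∑ n (g ∘ (true ∷_))
    halves false = ≈-refl
    halves true  = comm _ _

  ∑-delta : ∀ n (g : V n → C) (p : V n) → ∑ n (λ x → if does (x ≟ p) then g x else ε) ≈ g p
  ∑-delta zero    g []          = identityʳ (g [])
  ∑-delta (suc n) g (false ∷ p) = begin
    ∑ (suc n) (λ x → if does (x ≟ false ∷ p) then g x else ε)
      ≈⟨ ∑-suc n _ ⟩
    ∑ n (λ x → if does (x ≟ p) then g (false ∷ x) else ε) ∙ ∑ n (λ _ → ε)
      ≈⟨ ∙-cong (∑-delta n _ p) (∑ˡ-ε (allVecs n)) ⟩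
    g (false ∷ p) ∙ ε
      ≈⟨ identityʳ _ ⟩
    g (false ∷ p) ∎
  ∑-delta (suc n) g (true ∷ p) = begin
    ∑ (suc n) (λ x → if does (x ≟ true ∷ p) then g x else ε)
      ≈⟨ ∑-suc n _ ⟩
    ∑ n (λ _ → ε) ∙ ∑ n (λ x → if does (x ≟ p) then g (true ∷ x) else ε)
      ≈⟨ ∙-cong (∑ˡ-ε (allVecs n)) (∑-delta n _ p) ⟩
    ε ∙ g (true ∷ p)
      ≈⟨ identityˡ _ ⟩
    g (true ∷ p) ∎

  ∑-∈ : ∀ n (g : V n → C) (ps : List (V n)) → Unique ps →
        ∑ n (λ x → if does (any? (x ≟_) ps) then g x else ε) ≈ ∑ˡ ps g
  ∑-∈ n g []       []           = ∑ˡ-ε (allVecs n)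
  ∑-∈ n g (p ∷ ps) (p∉ps ∷ uniq) = begin
    ∑ n (λ x → if does (x ≟ p) ∨ does (any? (x ≟_) ps) then g x else ε)
      ≈⟨ ∑-cong n split ⟩
    ∑ n (λ x → (if does (x ≟ p) then g x else ε) ∙ (if does (any? (x ≟_) ps) then g x else ε))
      ≈⟨ ∑ˡ-∙ _ _ (allVecs n) ⟩
    ∑ n (λ x → if does (x ≟ p) then g x else ε) ∙ ∑ n (λ x → if does (any? (x ≟_) ps) then g x else ε)
      ≈⟨ ∙-cong (∑-delta n g p) (∑-∈ n g ps uniq) ⟩
    g p ∙ ∑ˡ ps g ∎
    where
    split : ∀ x → (if does (x ≟ p) ∨ does (any? (x ≟_) ps) then g x else ε)
                ≈ (if does (x ≟ p) then g x else ε) ∙ (if does (any? (x ≟_) ps) then g x else ε)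
    split x with x ≟ p
    ... | no _     = ≈-sym (identityˡ _)
    ... | yes refl rewrite dec-false (any? (p ≟_) ps) (Allₚ.All¬⇒¬Any p∉ps) = ≈-sym (identityʳ _)

module 𝔽₂Sum = Sum (CommutativeRing.+-commutativeMonoid xor-∧-commutativeRing)

D² : BoolFun n → V n → V n → V n → Bool
D² f u v a = f a xor f (u ⊕ a) xor f (v ⊕ a) xor f (u ⊕ v ⊕ a)

sumOn-flat : (f : BoolFun n) (a : V n) {u v : V n} → LinIndep2 u v → sumOn f (flat a u v) ≡ D² f u v a
sumOn-flat {n} f a {u} {v} li = begin
  𝔽₂Sum.∑ n (λ x → span u v (x ⊕ a) ∧ f x)
    ≡⟨ 𝔽₂Sum.∑-translate n _ a ⟨
  𝔽₂Sum.∑ n (λ x → span u v (x ⊕ a ⊕ a) ∧ f (x ⊕ a))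
    ≡⟨ 𝔽₂Sum.∑-cong n (λ x → trans (cong (λ y → span u v y ∧ f (x ⊕ a)) (⊕-cancelʳ a x))
                                   (∧≡if (span u v x) (f (x ⊕ a)))) ⟩
  𝔽₂Sum.∑ n (λ x → if span u v x then f (x ⊕ a) else false)
    ≡⟨ 𝔽₂Sum.∑-∈ n _ (spanPoints u v) (spanPoints-unique li) ⟩
  f (0V ⊕ a) xor f (u ⊕ a) xor f (v ⊕ a) xor f (u ⊕ v ⊕ a) xor false
    ≡⟨ cong₂ (λ p q → f p xor f (u ⊕ a) xor f (v ⊕ a) xor q) (⊕-identityˡ a) (xor-identityʳ _) ⟩
  D² f u v a ∎
  where open ≡-Reasoning

xor-self-cancel : ∀ p q → p xor p xor q xor q ≡ false
xor-self-cancel p q = trans (sym (xor-assoc p p _)) (trans (cong (_xor (q xor q)) (xor-same p)) (xor-same q))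

module _ (f : BoolFun n) (a : V n) where

  D²-zeroˡ : (v : V n) → D² f 0V v a ≡ false
  D²-zeroˡ v =
    trans (cong₂ (λ p q → f a xor f p xor f (v ⊕ a) xor f q) (⊕-identityˡ a) (cong (_⊕ a) (⊕-identityˡ v)))
          (xor-self-cancel (f a) (f (v ⊕ a)))

  D²-zeroʳ : (u : V n) → D² f u 0V a ≡ false
  D²-zeroʳ u =
    trans (cong₂ (λ p q → f a xor f (u ⊕ a) xor f p xor f q) (⊕-identityˡ a) (cong (_⊕ a) (⊕-identityʳ u)))
          (trans (regroup (f a) (f (u ⊕ a))) (xor-self-cancel (f a) (f (u ⊕ a))))
    where
    regroup : ∀ p q → p xor q xor p xor q ≡ p xor p xor q xor q
    regroup = solve-∀ 𝔽₂

  D²-diagonal : (u : V n) → D² f u u a ≡ false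
  D²-diagonal u =
    trans (cong (λ p → f a xor f (u ⊕ a) xor f (u ⊕ a) xor f p) (trans (cong (_⊕ a) (⊕-same u)) (⊕-identityˡ a)))
          (trans (regroup (f a) (f (u ⊕ a))) (xor-self-cancel (f a) (f (u ⊕ a))))
    where
    regroup : ∀ p q → p xor q xor q xor p ≡ p xor p xor q xor q
    regroup = solve-∀ 𝔽₂

  D²-dependent : {u v : V n} → ¬ LinIndep2 u v → D² f u v a ≡ false
  D²-dependent {u} {v} dependent with u ≟ 0V | v ≟ 0V | u ≟ v
  ... | yes refl | _        | _        = D²-zeroˡ v
  ... | no _     | yes refl | _        = D²-zeroʳ u
  ... | no _     | no _     | yes refl = D²-diagonal u
  ... | no u≢0   | no v≢0   | no u≢v   = contradiction (Equivalence.from (LinIndep2⇔ u v) (u≢0 , v≢0 , u≢v)) dependent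

sumOn-resp : (f : BoolFun n) {A B : Subset n} → A ≐ B → sumOn f A ≡ sumOn f B
sumOn-resp {n} f A≐B = 𝔽₂Sum.∑-cong n (λ x → cong (_∧ f x) (A≐B x))

module _ {n : ℕ} (f : BoolFun n) where

  odd? : (A : Subset n) → Dec (sumOn f A ≡ true)
  odd? A = sumOn f A Bool.≟ true

  oddFlats : List (Subset n)
  oddFlats = List.filter odd? (flats n)

  oddFlats-hasCard : HasCard (InN2 f) (List.length oddFlats)
  oddFlats-hasCard = oddFlats , refl
    , All.zip (Allₚ.filter⁺ odd? (flats-isFlat2 n) , Allₚ.all-filter odd? (flats n))
    , (λ A (A-flat , A-odd) → ∈ₛ-filter⁺ (≐-setoid n) odd? (λ A≐B A-odd → trans (sym (sumOn-resp f A≐B)) A-odd)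
                                 (flats-complete A-flat) A-odd)
    , AllPairsₚ.filter⁺ odd? (flats-unique n)

-- ℤ's operators are opened only inside this block, so that _*_ in the statement of proposition3p3 is ℕ's.
module _ where
  open import Data.Integer using (ℤ; +_; 0ℤ; 1ℤ; -1ℤ; _*_; _+_; -_; _-_)
  import Data.Integer.Properties as ℤₚ
  open import Data.Integer.Tactic.RingSolver using () renaming (solve-∀ to ℤ-solve-∀)

  open Sum ℤₚ.+-0-commutativeMonoid

  𝟙 : Bool → ℤ
  𝟙 b = if b then 1ℤ else 0ℤ

  pow2 : ℕ → ℤ
  pow2 n = + (2 ℕ.^ n)

  *-if : (c : ℤ) (b : Bool) {p : ℤ} → c * (if b then p else 0ℤ) ≡ (if b then c * p else 0ℤ)
  *-if c true  = refl
  *-if c false = ℤₚ.*-zeroʳ c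

  module _ {A : Set} where

    ∑ˡ-*ˡ : (c : ℤ) (g : A → ℤ) (xs : List A) → ∑ˡ xs (λ x → c * g x) ≡ c * ∑ˡ xs g
    ∑ˡ-*ˡ c g []       = sym (ℤₚ.*-zeroʳ c)
    ∑ˡ-*ˡ c g (x ∷ xs) = trans (cong (_+_ (c * g x)) (∑ˡ-*ˡ c g xs)) (sym (ℤₚ.*-distribˡ-+ c (g x) _))

    ∑ˡ-*ʳ : (c : ℤ) (g : A → ℤ) (xs : List A) → ∑ˡ xs (λ x → g x * c) ≡ ∑ˡ xs g * c
    ∑ˡ-*ʳ c g xs = trans (∑ˡ-cong xs (All.tabulate (λ {x} _ → ℤₚ.*-comm (g x) c)))
                         (trans (∑ˡ-*ˡ c g xs) (ℤₚ.*-comm c _))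

    ∑ˡ-const : (c : ℤ) (xs : List A) → ∑ˡ xs (λ _ → c) ≡ + List.length xs * c
    ∑ˡ-const c []       = refl
    ∑ˡ-const c (x ∷ xs) = trans (cong (_+_ c) (∑ˡ-const c xs)) (sym (ℤₚ.suc-* (+ List.length xs) c))

  length-allVecs : ∀ n → List.length (allVecs n) ≡ 2 ℕ.^ n
  length-allVecs zero    = refl
  length-allVecs (suc n) = begin
    List.length (List.map (false ∷_) (allVecs n) ++ List.map (true ∷_) (allVecs n))
      ≡⟨ Listₚ.length-++ (List.map (false ∷_) (allVecs n)) ⟩
    List.length (List.map (false ∷_) (allVecs n)) ℕ.+ List.length (List.map (true ∷_) (allVecs n))
      ≡⟨ cong₂ ℕ._+_ (Listₚ.length-map _ (allVecs n)) (Listₚ.length-map _ (allVecs n)) ⟩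
    List.length (allVecs n) ℕ.+ List.length (allVecs n)
      ≡⟨ cong (λ m → m ℕ.+ m) (length-allVecs n) ⟩
    2 ℕ.^ n ℕ.+ 2 ℕ.^ n
      ≡⟨ cong (2 ℕ.^ n ℕ.+_) (ℕₚ.+-identityʳ (2 ℕ.^ n)) ⟨
    2 ℕ.^ suc n ∎
    where open ≡-Reasoning

  ∑-const : ∀ n (c : ℤ) → ∑ n (λ _ → c) ≡ pow2 n * c
  ∑-const n c = trans (∑ˡ-const c (allVecs n)) (cong (λ m → + m * c) (length-allVecs n))

  sign-xor : ∀ a b → sign (a xor b) ≡ sign a * sign b
  sign-xor false false = refl
  sign-xor false true  = refl
  sign-xor true  false = refl
  sign-xor true  true  = refl

  sign-square : ∀ a → sign a * sign a ≡ 1ℤ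
  sign-square false = refl
  sign-square true  = refl

  χ : V n → V n → ℤ
  χ x b = sign ⟨ x , b ⟩

  χ-⊕ : (x y b : V n) → χ (x ⊕ y) b ≡ χ x b * χ y b
  χ-⊕ x y b = trans (cong sign (⟨⟩-⊕ˡ x y b)) (sign-xor ⟨ x , b ⟩ ⟨ y , b ⟩)

  ∑-χ : ∀ n (x : V n) → ∑ n (χ x) ≡ (if does (x ≟ 0V) then pow2 n else 0ℤ)
  ∑-χ zero    []          = refl
  ∑-χ (suc n) (false ∷ x) = begin
    ∑ (suc n) (χ (false ∷ x))
      ≡⟨ ∑-suc n _ ⟩
    ∑ n (χ x) + ∑ n (χ x)
      ≡⟨ cong (λ s → s + s) (∑-χ n x) ⟩
    (if does (x ≟ 0V) then pow2 n else 0ℤ) + (if does (x ≟ 0V) then pow2 n else 0ℤ)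
      ≡⟨ double (does (x ≟ 0V)) ⟩
    (if does (x ≟ 0V) then pow2 (suc n) else 0ℤ) ∎
    where
    open ≡-Reasoning
    double : ∀ b → (if b then pow2 n else 0ℤ) + (if b then pow2 n else 0ℤ) ≡ (if b then pow2 (suc n) else 0ℤ)
    double false = refl
    double true  = trans (sym (ℤₚ.pos-+ (2 ℕ.^ n) (2 ℕ.^ n))) (cong (λ m → + (2 ℕ.^ n ℕ.+ m)) (sym (ℕₚ.+-identityʳ (2 ℕ.^ n))))
  ∑-χ (suc n) (true ∷ x) = begin
    ∑ (suc n) (χ (true ∷ x))
      ≡⟨ ∑-suc n _ ⟩
    ∑ n (χ x) + ∑ n (λ b → sign (not ⟨ x , b ⟩))
      ≡⟨ cong (_+_ (∑ n (χ x))) (∑-cong n (λ b → sign-not ⟨ x , b ⟩)) ⟩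
    ∑ n (χ x) + ∑ n (λ b → -1ℤ * χ x b)
      ≡⟨ cong (_+_ (∑ n (χ x))) (trans (∑ˡ-*ˡ -1ℤ (χ x) (allVecs n)) (ℤₚ.-1*i≡-i _)) ⟩
    ∑ n (χ x) - ∑ n (χ x)
      ≡⟨ ℤₚ.+-inverseʳ (∑ n (χ x)) ⟩
    0ℤ ∎
    where
    open ≡-Reasoning
    sign-not : ∀ a → sign (not a) ≡ -1ℤ * sign a
    sign-not false = refl
    sign-not true  = refl

  𝓕 : (V n → ℤ) → V n → ℤ
  𝓕 {n} g b = ∑ n (λ x → g x * χ x b)

  walsh≡𝓕 : (f : BoolFun n) (b : V n) → walsh f b ≡ 𝓕 (sign ∘ f) b
  walsh≡𝓕 {n} f b = ∑-cong n (λ x → sign-xor (f x) ⟨ x , b ⟩)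

  𝓕-square : (g : V n → ℤ) (b : V n) → 𝓕 g b * 𝓕 g b ≡ ∑ n (λ x → ∑ n (λ y → (g x * g y) * χ (x ⊕ y) b))
  𝓕-square {n} g b = begin
    𝓕 g b * 𝓕 g b
      ≡⟨ ∑ˡ-*ʳ (𝓕 g b) _ (allVecs n) ⟨
    ∑ n (λ x → (g x * χ x b) * 𝓕 g b)
      ≡⟨ ∑-cong n (λ x → ∑ˡ-*ˡ (g x * χ x b) _ (allVecs n)) ⟨
    ∑ n (λ x → ∑ n (λ y → (g x * χ x b) * (g y * χ y b)))
      ≡⟨ ∑-cong n (λ x → ∑-cong n (λ y → trans (interchange (g x) (χ x b) (g y) (χ y b))
                                               (cong ((g x * g y) *_) (sym (χ-⊕ x y b))))) ⟩
    ∑ n (λ x → ∑ n (λ y → (g x * g y) * χ (x ⊕ y) b)) ∎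
    where
    open ≡-Reasoning
    interchange : ∀ a b c d → (a * b) * (c * d) ≡ (a * c) * (b * d)
    interchange = ℤ-solve-∀

  parseval : (g : V n → ℤ) → ∑ n (λ b → 𝓕 g b * 𝓕 g b) ≡ pow2 n * ∑ n (λ x → g x * g x)
  parseval {n} g = begin
    ∑ n (λ b → 𝓕 g b * 𝓕 g b)
      ≡⟨ ∑-cong n (𝓕-square g) ⟩
    ∑ n (λ b → ∑ n (λ x → ∑ n (λ y → (g x * g y) * χ (x ⊕ y) b)))
      ≡⟨ ∑ˡ-comm _ (allVecs n) (allVecs n) ⟩
    ∑ n (λ x → ∑ n (λ b → ∑ n (λ y → (g x * g y) * χ (x ⊕ y) b)))
      ≡⟨ ∑-cong n (λ x → ∑ˡ-comm _ (allVecs n) (allVecs n)) ⟩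
    ∑ n (λ x → ∑ n (λ y → ∑ n (λ b → (g x * g y) * χ (x ⊕ y) b)))
      ≡⟨ ∑-cong n (λ x → ∑-cong n (orthogonality x)) ⟩
    ∑ n (λ x → ∑ n (λ y → if does (y ≟ x) then (g x * g y) * pow2 n else 0ℤ))
      ≡⟨ ∑-cong n (λ x → ∑-delta n _ x) ⟩
    ∑ n (λ x → (g x * g x) * pow2 n)
      ≡⟨ ∑ˡ-*ʳ (pow2 n) _ (allVecs n) ⟩
    ∑ n (λ x → g x * g x) * pow2 n
      ≡⟨ ℤₚ.*-comm _ (pow2 n) ⟩
    pow2 n * ∑ n (λ x → g x * g x) ∎
    where
    open ≡-Reasoning
    orthogonality : ∀ x y → ∑ n (λ b → (g x * g y) * χ (x ⊕ y) b) ≡ (if does (y ≟ x) then (g x * g y) * pow2 n else 0ℤ)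
    orthogonality x y = begin
      ∑ n (λ b → (g x * g y) * χ (x ⊕ y) b)
        ≡⟨ ∑ˡ-*ˡ (g x * g y) _ (allVecs n) ⟩
      (g x * g y) * ∑ n (χ (x ⊕ y))
        ≡⟨ cong ((g x * g y) *_) (∑-χ n (x ⊕ y)) ⟩
      (g x * g y) * (if does (x ⊕ y ≟ 0V) then pow2 n else 0ℤ)
        ≡⟨ cong (λ d → (g x * g y) * (if d then pow2 n else 0ℤ)) (does-⇔ (⊕≡0⇔≡ x y) (x ⊕ y ≟ 0V) (y ≟ x)) ⟩
      (g x * g y) * (if does (y ≟ x) then pow2 n else 0ℤ)
        ≡⟨ *-if (g x * g y) (does (y ≟ x)) ⟩
      (if does (y ≟ x) then (g x * g y) * pow2 n else 0ℤ) ∎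

  ∑³ : ∀ n → (V n → V n → V n → ℤ) → ℤ
  ∑³ n h = ∑ n λ v → ∑ n λ x → ∑ n λ u → h x u v

  ∑³-cong : ∀ n {g h : V n → V n → V n → ℤ} → (∀ x u v → g x u v ≡ h x u v) → ∑³ n g ≡ ∑³ n h
  ∑³-cong n e = ∑-cong n (λ v → ∑-cong n (λ x → ∑-cong n (λ u → e x u v)))

  autocorrelation : BoolFun n → V n → ℤ
  autocorrelation {n} f v = ∑ n (λ x → sign (f x) * sign (f (v ⊕ x)))

  module _ {n : ℕ} (f : BoolFun n) where

    private
      s : V n → ℤ
      s = sign ∘ f

    𝓕-square≡𝓕-autocorrelation : (b : V n) → 𝓕 s b * 𝓕 s b ≡ 𝓕 (autocorrelation f) b
    𝓕-square≡𝓕-autocorrelation b = begin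
      𝓕 s b * 𝓕 s b
        ≡⟨ 𝓕-square s b ⟩
      ∑ n (λ x → ∑ n (λ y → (s x * s y) * χ (x ⊕ y) b))
        ≡⟨ ∑-cong n (λ x → ∑-translate n _ x) ⟨
      ∑ n (λ x → ∑ n (λ v → (s x * s (v ⊕ x)) * χ (x ⊕ (v ⊕ x)) b))
        ≡⟨ ∑-cong n (λ x → ∑-cong n (λ v → cong (λ w → (s x * s (v ⊕ x)) * χ w b) (x⊕[v⊕x]≡v x v))) ⟩
      ∑ n (λ x → ∑ n (λ v → (s x * s (v ⊕ x)) * χ v b))
        ≡⟨ ∑ˡ-comm _ (allVecs n) (allVecs n) ⟩
      ∑ n (λ v → ∑ n (λ x → (s x * s (v ⊕ x)) * χ v b))
        ≡⟨ ∑-cong n (λ v → ∑ˡ-*ʳ (χ v b) _ (allVecs n)) ⟩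
      𝓕 (autocorrelation f) b ∎
      where
      open ≡-Reasoning
      x⊕[v⊕x]≡v : ∀ x v → x ⊕ (v ⊕ x) ≡ v
      x⊕[v⊕x]≡v x v = trans (cong (x ⊕_) (⊕-comm v x)) (⊕-cancelˡ x v)

    sign-D² : (u v x : V n) → sign (D² f u v x) ≡ s x * (s (u ⊕ x) * (s (v ⊕ x) * s (u ⊕ v ⊕ x)))
    sign-D² u v x =
      trans (sign-xor (f x) _) (cong (s x *_) (trans (sign-xor (f (u ⊕ x)) _) (cong (s (u ⊕ x) *_) (sign-xor (f (v ⊕ x)) _))))

    autocorrelation-square : (v : V n) →
      autocorrelation f v * autocorrelation f v ≡ ∑ n (λ x → ∑ n (λ u → sign (D² f u v x)))
    autocorrelation-square v = begin
      autocorrelation f v * autocorrelation f v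
        ≡⟨ ∑ˡ-*ʳ (autocorrelation f v) _ (allVecs n) ⟨
      ∑ n (λ x → (s x * s (v ⊕ x)) * autocorrelation f v)
        ≡⟨ ∑-cong n (λ x → ∑ˡ-*ˡ (s x * s (v ⊕ x)) _ (allVecs n)) ⟨
      ∑ n (λ x → ∑ n (λ y → (s x * s (v ⊕ x)) * (s y * s (v ⊕ y))))
        ≡⟨ ∑-cong n (λ x → ∑-translate n _ x) ⟨
      ∑ n (λ x → ∑ n (λ u → (s x * s (v ⊕ x)) * (s (u ⊕ x) * s (v ⊕ (u ⊕ x)))))
        ≡⟨ ∑-cong n (λ x → ∑-cong n (λ u → trans (cong (λ w → (s x * s (v ⊕ x)) * (s (u ⊕ x) * s w)) (v⊕[u⊕x] u v x))
                                                    (regroup (s x) (s (v ⊕ x)) (s (u ⊕ x)) (s (u ⊕ v ⊕ x))))) ⟩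
      ∑ n (λ x → ∑ n (λ u → s x * (s (u ⊕ x) * (s (v ⊕ x) * s (u ⊕ v ⊕ x)))))
        ≡⟨ ∑-cong n (λ x → ∑-cong n (λ u → sign-D² u v x)) ⟨
      ∑ n (λ x → ∑ n (λ u → sign (D² f u v x))) ∎
      where
      open ≡-Reasoning
      v⊕[u⊕x] : ∀ u v x → v ⊕ (u ⊕ x) ≡ u ⊕ v ⊕ x
      v⊕[u⊕x] u v x = trans (sym (⊕-assoc v u x)) (cong (_⊕ x) (⊕-comm v u))
      regroup : ∀ a c b d → (a * c) * (b * d) ≡ a * (b * (c * d))
      regroup = ℤ-solve-∀

    ∑-𝓕⁴ : ∑ n (λ b → (𝓕 s b * 𝓕 s b) * (𝓕 s b * 𝓕 s b)) ≡ pow2 n * ∑³ n (λ x u v → sign (D² f u v x))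
    ∑-𝓕⁴ = begin
      ∑ n (λ b → (𝓕 s b * 𝓕 s b) * (𝓕 s b * 𝓕 s b))
        ≡⟨ ∑-cong n (λ b → cong (λ w → w * w) (𝓕-square≡𝓕-autocorrelation b)) ⟩
      ∑ n (λ b → 𝓕 (autocorrelation f) b * 𝓕 (autocorrelation f) b)
        ≡⟨ parseval (autocorrelation f) ⟩
      pow2 n * ∑ n (λ v → autocorrelation f v * autocorrelation f v)
        ≡⟨ cong (pow2 n *_) (∑-cong n autocorrelation-square) ⟩
      pow2 n * ∑³ n (λ x u v → sign (D² f u v x)) ∎
      where open ≡-Reasoning

  ⌊2*k/2⌋≡k : ∀ k → ℕ.⌊ 2 ℕ.* k /2⌋ ≡ k
  ⌊2*k/2⌋≡k zero    = refl
  ⌊2*k/2⌋≡k (suc k) = trans (cong ℕ.⌊_/2⌋ (ℕₚ.*-suc 2 k)) (cong suc (⌊2*k/2⌋≡k k))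

  pow2-half-square : Odd n → pow2 ℕ.⌊ suc n /2⌋ * pow2 ℕ.⌊ suc n /2⌋ ≡ pow2 (suc n)
  pow2-half-square (k , refl) = begin
    pow2 (suc ℕ.⌊ 2 ℕ.* k /2⌋) * pow2 (suc ℕ.⌊ 2 ℕ.* k /2⌋)
      ≡⟨ cong (λ h → pow2 (suc h) * pow2 (suc h)) (⌊2*k/2⌋≡k k) ⟩
    pow2 (suc k) * pow2 (suc k)
      ≡⟨ ℤₚ.pos-* (2 ℕ.^ suc k) (2 ℕ.^ suc k) ⟨
    + (2 ℕ.^ suc k ℕ.* 2 ℕ.^ suc k)
      ≡⟨ cong +_ (ℕₚ.^-distribˡ-+-* 2 (suc k) (suc k)) ⟨
    + (2 ℕ.^ (suc k ℕ.+ suc k))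
      ≡⟨ cong (λ m → + (2 ℕ.^ m)) (k+1+k+1 k) ⟩
    pow2 (suc (suc (2 ℕ.* k))) ∎
    where
    open ≡-Reasoning
    k+1+k+1 : ∀ k → suc k ℕ.+ suc k ≡ suc (suc (2 ℕ.* k))
    k+1+k+1 = ℕ-solve-∀

  semiBent-value-square : Odd n → (w : ℤ) →
    w ≡ + 0 ⊎ (w ≡ + (2 ℕ.^ ℕ.⌊ suc n /2⌋) ⊎ w ≡ - + (2 ℕ.^ ℕ.⌊ suc n /2⌋)) → w * w ≡ 0ℤ ⊎ w * w ≡ pow2 (suc n)
  semiBent-value-square     odd w (inj₁ refl)         = inj₁ refl
  semiBent-value-square     odd w (inj₂ (inj₁ refl)) = inj₂ (pow2-half-square odd)
  semiBent-value-square {n} odd w (inj₂ (inj₂ refl)) = inj₂ (trans (neg*neg (pow2 ℕ.⌊ suc n /2⌋)) (pow2-half-square odd))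
    where
    neg*neg : ∀ p → (- p) * (- p) ≡ p * p
    neg*neg = ℤ-solve-∀

  w⁴≡c*w² : ∀ {w c : ℤ} → w * w ≡ 0ℤ ⊎ w * w ≡ c → (w * w) * (w * w) ≡ c * (w * w)
  w⁴≡c*w² {w} {c} (inj₁ e) = trans (cong (_* (w * w)) e) (sym (trans (cong (c *_) e) (ℤₚ.*-zeroʳ c)))
  w⁴≡c*w² {w} {c} (inj₂ e) = cong (_* (w * w)) e

  ∑³-sign-D²-semiBent : Odd n → (f : BoolFun n) → SemiBent n f →
    ∑³ n (λ x u v → sign (D² f u v x)) ≡ pow2 (suc n) * pow2 n
  ∑³-sign-D²-semiBent {n} odd f semiBent = ℤₚ.*-cancelˡ-≡ (pow2 n) _ _ {{ℕₚ.m^n≢0 2 n}} (begin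
    pow2 n * ∑³ n (λ x u v → sign (D² f u v x))
      ≡⟨ ∑-𝓕⁴ f ⟨
    ∑ n (λ b → (W b * W b) * (W b * W b))
      ≡⟨ ∑-cong n (λ b → w⁴≡c*w² {W b} (W-square b)) ⟩
    ∑ n (λ b → pow2 (suc n) * (W b * W b))
      ≡⟨ ∑ˡ-*ˡ (pow2 (suc n)) _ (allVecs n) ⟩
    pow2 (suc n) * ∑ n (λ b → W b * W b)
      ≡⟨ cong (pow2 (suc n) *_) (parseval (sign ∘ f)) ⟩
    pow2 (suc n) * (pow2 n * ∑ n (λ x → sign (f x) * sign (f x)))
      ≡⟨ cong (λ t → pow2 (suc n) * (pow2 n * t)) (trans (∑-cong n (sign-square ∘ f)) (∑-const n 1ℤ)) ⟩
    pow2 (suc n) * (pow2 n * (pow2 n * 1ℤ))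
      ≡⟨ rearrange (pow2 (suc n)) (pow2 n) ⟩
    pow2 n * (pow2 (suc n) * pow2 n) ∎)
    where
    open ≡-Reasoning
    W = 𝓕 (sign ∘ f)
    W-square : ∀ b → W b * W b ≡ 0ℤ ⊎ W b * W b ≡ pow2 (suc n)
    W-square b = subst (λ w → w * w ≡ 0ℤ ⊎ w * w ≡ pow2 (suc n)) (walsh≡𝓕 f b)
                       (semiBent-value-square odd (walsh f b) (semiBent b))
    rearrange : ∀ a p → a * (p * (p * 1ℤ)) ≡ p * (a * p)
    rearrange = ℤ-solve-∀

  𝟙-D² : (f : BoolFun n) (a u v : V n) →
    𝟙 (D² f u v a) ≡ (if does (independent? u v) then 𝟙 (sumOn f (flat a u v)) else 0ℤ)
  𝟙-D² f a u v with independent? u v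
  ... | yes li        = cong 𝟙 (sym (sumOn-flat f a li))
  ... | no dependent = cong 𝟙 (D²-dependent f a dependent)

  ∣_∣ : Subset n → ℤ
  ∣_∣ {n} A = ∑ n (λ x → 𝟙 (A x))

  ∣span∣ : {u v : V n} → LinIndep2 u v → ∣ span u v ∣ ≡ + 4
  ∣span∣ {n} {u} {v} li = ∑-∈ n (λ _ → 1ℤ) (spanPoints u v) (spanPoints-unique li)

  ∣flat∣ : (a : V n) {u v : V n} → LinIndep2 u v → ∣ flat a u v ∣ ≡ + 4
  ∣flat∣ {n} a {u} {v} li = trans (∑-translate n (λ y → 𝟙 (span u v y)) a) (∣span∣ li)

  if-𝟙 : ∀ a b → (if a then 𝟙 b else 0ℤ) ≡ 𝟙 (a ∧ b)
  if-𝟙 false b = refl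
  if-𝟙 true  b = refl

  𝟙-∧ : ∀ a b → 𝟙 (a ∧ b) ≡ 𝟙 a * 𝟙 b
  𝟙-∧ false b = refl
  𝟙-∧ true  b = sym (ℤₚ.*-identityˡ (𝟙 b))

  ∣∣-remove : (P : Subset n) {p : V n} → p ∈S P → ∣ P ∣ ≡ ∑ n (λ y → 𝟙 (P y ∧ not (does (y ≟ p)))) + 1ℤ
  ∣∣-remove {n} P {p} p∈P = begin
    ∑ n (λ y → 𝟙 (P y))
      ≡⟨ ∑-cong n (λ y → split (P y) (does (y ≟ p))) ⟩
    ∑ n (λ y → 𝟙 (P y ∧ not (does (y ≟ p))) + (if does (y ≟ p) then 𝟙 (P y) else 0ℤ))
      ≡⟨ ∑ˡ-∙ _ _ (allVecs n) ⟩
    ∑ n (λ y → 𝟙 (P y ∧ not (does (y ≟ p)))) + ∑ n (λ y → if does (y ≟ p) then 𝟙 (P y) else 0ℤ)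
      ≡⟨ cong (_+_ (∑ n (λ y → 𝟙 (P y ∧ not (does (y ≟ p)))))) (trans (∑-delta n (λ y → 𝟙 (P y)) p) (cong 𝟙 p∈P)) ⟩
    ∑ n (λ y → 𝟙 (P y ∧ not (does (y ≟ p)))) + 1ℤ ∎
    where
    open ≡-Reasoning
    split : ∀ a e → 𝟙 a ≡ 𝟙 (a ∧ not e) + (if e then 𝟙 a else 0ℤ)
    split false false = refl
    split false true  = refl
    split true  false = refl
    split true  true  = refl

  ∣ordered-pairs∣ : (Q : Subset n) →
    ∑ n (λ v → ∑ n (λ u → 𝟙 (Q v) * 𝟙 (Q u ∧ not (does (u ≟ v))))) ≡ ∣ Q ∣ * (∣ Q ∣ - 1ℤ)
  ∣ordered-pairs∣ {n} Q = begin
    ∑ n (λ v → ∑ n (λ u → 𝟙 (Q v) * 𝟙 (Q u ∧ not (does (u ≟ v)))))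
      ≡⟨ ∑-cong n (λ v → ∑ˡ-*ˡ (𝟙 (Q v)) _ (allVecs n)) ⟩
    ∑ n (λ v → 𝟙 (Q v) * ∑ n (λ u → 𝟙 (Q u ∧ not (does (u ≟ v)))))
      ≡⟨ ∑-cong n others ⟩
    ∑ n (λ v → 𝟙 (Q v) * (∣ Q ∣ - 1ℤ))
      ≡⟨ ∑ˡ-*ʳ (∣ Q ∣ - 1ℤ) _ (allVecs n) ⟩
    ∣ Q ∣ * (∣ Q ∣ - 1ℤ) ∎
    where
    open ≡-Reasoning
    others : ∀ v → 𝟙 (Q v) * ∑ n (λ u → 𝟙 (Q u ∧ not (does (u ≟ v)))) ≡ 𝟙 (Q v) * (∣ Q ∣ - 1ℤ)
    others v with Q v in v∈Q
    ... | false = refl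
    ... | true  = cong (1ℤ *_) (trans (sym (+-minus _ _)) (cong (_- 1ℤ) (sym (∣∣-remove Q v∈Q))))
      where
      +-minus : ∀ a b → (a + b) - b ≡ a
      +-minus = ℤ-solve-∀

  ∑³-factor : (F Q : Subset n) →
    ∑³ n (λ x u v → 𝟙 (F x) * (𝟙 (Q v) * 𝟙 (Q u ∧ not (does (u ≟ v))))) ≡ ∣ F ∣ * (∣ Q ∣ * (∣ Q ∣ - 1ℤ))
  ∑³-factor {n} F Q = begin
    ∑ n (λ v → ∑ n (λ x → ∑ n (λ u → 𝟙 (F x) * pair u v)))
      ≡⟨ ∑-cong n (λ v → ∑-cong n (λ x → ∑ˡ-*ˡ (𝟙 (F x)) (λ u → pair u v) (allVecs n))) ⟩
    ∑ n (λ v → ∑ n (λ x → 𝟙 (F x) * ∑ n (λ u → pair u v)))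
      ≡⟨ ∑-cong n (λ v → ∑ˡ-*ʳ (∑ n (λ u → pair u v)) (λ x → 𝟙 (F x)) (allVecs n)) ⟩
    ∑ n (λ v → ∣ F ∣ * ∑ n (λ u → pair u v))
      ≡⟨ ∑ˡ-*ˡ ∣ F ∣ _ (allVecs n) ⟩
    ∣ F ∣ * ∑ n (λ v → ∑ n (λ u → pair u v))
      ≡⟨ cong (∣ F ∣ *_) (∣ordered-pairs∣ Q) ⟩
    ∣ F ∣ * (∣ Q ∣ * (∣ Q ∣ - 1ℤ)) ∎
    where
    open ≡-Reasoning
    pair : V n → V n → ℤ
    pair u v = 𝟙 (Q v) * 𝟙 (Q u ∧ not (does (u ≟ v)))

  module _ (a : V n) {u₀ v₀ : V n} where

    private
      F U Q : Subset n
      F = flat a u₀ v₀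
      U = span u₀ v₀
      Q y = U y ∧ not (does (y ≟ 0V))

    flat≐-indicator : (x u v : V n) →
      does (independent? u v) ∧ does (flat x u v ≐? F) ≡ F x ∧ (Q v ∧ (Q u ∧ not (does (u ≟ v))))
    flat≐-indicator x u v = ⇔→≡ (mk⇔ to from)
      where
      to : does (independent? u v) ∧ does (flat x u v ≐? F) ≡ true → F x ∧ (Q v ∧ (Q u ∧ not (does (u ≟ v)))) ≡ true
      to h with Equivalence.to ∧≡true⇔ h
      ... | i , e with Equivalence.to (does≡true⇔ (independent? u v)) i
      ... | li with Equivalence.to (flat≐flat⇔ a li) (Equivalence.to (does≡true⇔ (flat x u v ≐? F)) e)
                 | Equivalence.to (LinIndep2⇔ u v) li
      ... | x∈ , u∈ , v∈ | u≢0 , v≢0 , u≢v = ∧-intro x∈ (∧-intro (∧-intro v∈ (¬-intro (v ≟ 0V) v≢0))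
                                                      (∧-intro (∧-intro u∈ (¬-intro (u ≟ 0V) u≢0)) (¬-intro (u ≟ v) u≢v)))
        where
        ∧-intro : ∀ {a b} → a ≡ true → b ≡ true → a ∧ b ≡ true
        ∧-intro p q = Equivalence.from ∧≡true⇔ (p , q)
        ¬-intro : ∀ {A : Set} (a? : Dec A) → ¬ A → not (does a?) ≡ true
        ¬-intro a? = Equivalence.from (not-does≡true⇔ a?)
      from : F x ∧ (Q v ∧ (Q u ∧ not (does (u ≟ v)))) ≡ true → does (independent? u v) ∧ does (flat x u v ≐? F) ≡ true
      from h with Equivalence.to ∧≡true⇔ h
      ... | x∈ , h′ with Equivalence.to ∧≡true⇔ h′
      ... | Qv , h″ with Equivalence.to ∧≡true⇔ Qv | Equivalence.to ∧≡true⇔ h″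
      ... | v∈ , v≢0 | Qu , u≢v with Equivalence.to ∧≡true⇔ Qu
      ... | u∈ , u≢0 = Equivalence.from ∧≡true⇔ (Equivalence.from (does≡true⇔ (independent? u v)) li ,
                         Equivalence.from (does≡true⇔ (flat x u v ≐? F)) (Equivalence.from (flat≐flat⇔ a li) (x∈ , u∈ , v∈)))
        where
        li : LinIndep2 u v
        li = Equivalence.from (LinIndep2⇔ u v) (Equivalence.to (not-does≡true⇔ (u ≟ 0V)) u≢0 ,
               Equivalence.to (not-does≡true⇔ (v ≟ 0V)) v≢0 , Equivalence.to (not-does≡true⇔ (u ≟ v)) u≢v)

    flat-multiplicity₀ : LinIndep2 u₀ v₀ →
      ∑³ n (λ x u v → if does (independent? u v) then 𝟙 (does (flat x u v ≐? F)) else 0ℤ) ≡ + 24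
    flat-multiplicity₀ li₀ = begin
      ∑³ n (λ x u v → if does (independent? u v) then 𝟙 (does (flat x u v ≐? F)) else 0ℤ)
        ≡⟨ ∑³-cong n factorise ⟩
      ∑³ n (λ x u v → 𝟙 (F x) * (𝟙 (Q v) * 𝟙 (Q u ∧ not (does (u ≟ v)))))
        ≡⟨ ∑³-factor F Q ⟩
      ∣ F ∣ * (∣ Q ∣ * (∣ Q ∣ - 1ℤ))
        ≡⟨ cong₂ (λ p q → p * (q * (q - 1ℤ))) (∣flat∣ a li₀) ∣Q∣≡3 ⟩
      + 24 ∎
      where
      open ≡-Reasoning
      factorise : ∀ x u v → (if does (independent? u v) then 𝟙 (does (flat x u v ≐? F)) else 0ℤ)
                          ≡ 𝟙 (F x) * (𝟙 (Q v) * 𝟙 (Q u ∧ not (does (u ≟ v))))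
      factorise x u v = begin
        (if does (independent? u v) then 𝟙 (does (flat x u v ≐? F)) else 0ℤ)
          ≡⟨ if-𝟙 (does (independent? u v)) _ ⟩
        𝟙 (does (independent? u v) ∧ does (flat x u v ≐? F))
          ≡⟨ cong 𝟙 (flat≐-indicator x u v) ⟩
        𝟙 (F x ∧ (Q v ∧ (Q u ∧ not (does (u ≟ v)))))
          ≡⟨ trans (𝟙-∧ (F x) _) (cong (𝟙 (F x) *_) (𝟙-∧ (Q v) _)) ⟩
        𝟙 (F x) * (𝟙 (Q v) * 𝟙 (Q u ∧ not (does (u ≟ v)))) ∎
      ∣Q∣≡3 : ∣ Q ∣ ≡ + 3
      ∣Q∣≡3 = begin
        ∣ Q ∣              ≡⟨ +-minus ∣ Q ∣ 1ℤ ⟨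
        ∣ Q ∣ + 1ℤ - 1ℤ    ≡⟨ cong (_- 1ℤ) (trans (sym (∣∣-remove U (0∈span u₀ v₀))) (∣span∣ li₀)) ⟩
        + 3                ∎
        where
        +-minus : ∀ a b → a + b - b ≡ a
        +-minus = ℤ-solve-∀

  flat-multiplicity : {F : Subset n} → IsFlat2 F →
    ∑³ n (λ x u v → if does (independent? u v) then 𝟙 (does (flat x u v ≐? F)) else 0ℤ) ≡ + 24
  flat-multiplicity {n} {F} F-flat with IsFlat2⇒flat F-flat
  ... | a , u₀ , v₀ , li₀ , F≐flat = trans (∑³-cong n same-indicator) (flat-multiplicity₀ a li₀)
    where
    same-indicator : ∀ x u v → (if does (independent? u v) then 𝟙 (does (flat x u v ≐? F)) else 0ℤ)
                             ≡ (if does (independent? u v) then 𝟙 (does (flat x u v ≐? flat a u₀ v₀)) else 0ℤ)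
    same-indicator x u v = cong (λ b → if does (independent? u v) then 𝟙 b else 0ℤ)
      (does-⇔ (mk⇔ (λ e → ≐-trans e F≐flat) (λ e → ≐-trans e (≐-sym F≐flat)))
              (flat x u v ≐? F) (flat x u v ≐? flat a u₀ v₀))

  ∑³-independent : ∀ n → ∑³ n (λ x u v → if does (independent? u v) then 1ℤ else 0ℤ)
                        ≡ pow2 n * ((pow2 n - 1ℤ) * (pow2 n - 1ℤ - 1ℤ))
  ∑³-independent n = begin
    ∑³ n (λ x u v → 𝟙 (does (independent? u v)))
      ≡⟨ ∑³-cong n (λ x u v → factorise u v) ⟩
    ∑³ n (λ x u v → 𝟙 true * (𝟙 (Q v) * 𝟙 (Q u ∧ not (does (u ≟ v)))))
      ≡⟨ ∑³-factor full Q ⟩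
    ∣ full ∣ * (∣ Q ∣ * (∣ Q ∣ - 1ℤ))
      ≡⟨ cong₂ (λ p q → p * (q * (q - 1ℤ))) ∣full∣ ∣Q∣ ⟩
    pow2 n * ((pow2 n - 1ℤ) * (pow2 n - 1ℤ - 1ℤ)) ∎
    where
    open ≡-Reasoning
    full Q : Subset n
    full _ = true
    Q y = not (does (y ≟ 0V))
    factorise : ∀ u v → 𝟙 (does (independent? u v)) ≡ 𝟙 true * (𝟙 (Q v) * 𝟙 (Q u ∧ not (does (u ≟ v))))
    factorise u v = trans (cong 𝟙 (trans (does-independent? u v) (swap (Q u) (Q v) _)))
                          (trans (𝟙-∧ (Q v) _) (sym (ℤₚ.*-identityˡ _)))
      where
      swap : ∀ a b c → a ∧ (b ∧ c) ≡ b ∧ (a ∧ c)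
      swap = solve-∀ 𝔽₂
    ∣full∣ : ∣ full ∣ ≡ pow2 n
    ∣full∣ = trans (∑-const n 1ℤ) (ℤₚ.*-identityʳ (pow2 n))
    ∣Q∣ : ∣ Q ∣ ≡ pow2 n - 1ℤ
    ∣Q∣ = begin
      ∣ Q ∣               ≡⟨ +-minus ∣ Q ∣ 1ℤ ⟨
      ∣ Q ∣ + 1ℤ - 1ℤ     ≡⟨ cong (_- 1ℤ) (trans (sym (∣∣-remove full refl)) ∣full∣) ⟩
      pow2 n - 1ℤ         ∎
      where
      +-minus : ∀ a b → a + b - b ≡ a
      +-minus = ℤ-solve-∀

  ∑ˡ-match : (g : Subset n → ℤ) → (∀ {A B} → A ≐ B → g A ≡ g B) → {X : Subset n} (L : List (Subset n)) →
    AllPairs (λ A B → ¬ A ≐ B) L → Any (X ≐_) L → ∑ˡ L (λ F → if does (X ≐? F) then g F else 0ℤ) ≡ g X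
  ∑ˡ-match g resp {X} (F ∷ L) (F≉L ∷ _) (here X≐F) with X ≐? F
  ... | no X≉F = contradiction X≐F X≉F
  ... | yes _  = trans (cong (_+_ (g F)) none) (trans (ℤₚ.+-identityʳ (g F)) (sym (resp X≐F)))
    where
    none : ∑ˡ L (λ F′ → if does (X ≐? F′) then g F′ else 0ℤ) ≡ 0ℤ
    none = trans (∑ˡ-cong L (All.map (λ F≉F′ → cong (λ b → if b then _ else 0ℤ)
                   (dec-false (X ≐? _) (F≉F′ ∘ ≐-trans (≐-sym X≐F)))) F≉L)) (∑ˡ-ε L)
  ∑ˡ-match g resp {X} (F ∷ L) (F≉L ∷ uniq) (there X∈L) with X ≐? F
  ... | yes X≐F = contradiction (Any.map (≐-trans (≐-sym X≐F)) X∈L) (Allₚ.All¬⇒¬Any F≉L)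
  ... | no _    = trans (ℤₚ.+-identityˡ _) (∑ˡ-match g resp L uniq X∈L)

  ∑³-∑ˡ-comm : {A : Set} (L : List A) (h : A → V n → V n → V n → ℤ) →
    ∑³ n (λ x u v → ∑ˡ L (λ F → h F x u v)) ≡ ∑ˡ L (λ F → ∑³ n (h F))
  ∑³-∑ˡ-comm {n} L h = begin
    ∑ n (λ v → ∑ n (λ x → ∑ n (λ u → ∑ˡ L (λ F → h F x u v))))
      ≡⟨ ∑-cong n (λ v → ∑-cong n (λ x → ∑ˡ-comm _ (allVecs n) L)) ⟩
    ∑ n (λ v → ∑ n (λ x → ∑ˡ L (λ F → ∑ n (λ u → h F x u v))))
      ≡⟨ ∑-cong n (λ v → ∑ˡ-comm _ (allVecs n) L) ⟩
    ∑ n (λ v → ∑ˡ L (λ F → ∑ n (λ x → ∑ n (λ u → h F x u v))))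
      ≡⟨ ∑ˡ-comm _ (allVecs n) L ⟩
    ∑ˡ L (λ F → ∑³ n (h F)) ∎
    where open ≡-Reasoning

  ∑³-*ʳ : (c : ℤ) (h : V n → V n → V n → ℤ) → ∑³ n (λ x u v → h x u v * c) ≡ ∑³ n h * c
  ∑³-*ʳ {n} c h = begin
    ∑ n (λ v → ∑ n (λ x → ∑ n (λ u → h x u v * c)))
      ≡⟨ ∑-cong n (λ v → ∑-cong n (λ x → ∑ˡ-*ʳ c _ (allVecs n))) ⟩
    ∑ n (λ v → ∑ n (λ x → ∑ n (λ u → h x u v) * c))
      ≡⟨ ∑-cong n (λ v → ∑ˡ-*ʳ c _ (allVecs n)) ⟩
    ∑ n (λ v → ∑ n (λ x → ∑ n (λ u → h x u v)) * c)
      ≡⟨ ∑ˡ-*ʳ c _ (allVecs n) ⟩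
    ∑³ n h * c ∎
    where open ≡-Reasoning

  double-count : (g : Subset n → ℤ) → (∀ {A B} → A ≐ B → g A ≡ g B) →
    ∑³ n (λ x u v → if does (independent? u v) then g (flat x u v) else 0ℤ) ≡ + 24 * ∑ˡ (flats n) g
  double-count {n} g resp = begin
    ∑³ n (λ x u v → if does (independent? u v) then g (flat x u v) else 0ℤ)
      ≡⟨ ∑³-cong n match ⟩
    ∑³ n (λ x u v → ∑ˡ (flats n) (λ F → h F x u v))
      ≡⟨ ∑³-∑ˡ-comm (flats n) h ⟩
    ∑ˡ (flats n) (λ F → ∑³ n (h F))
      ≡⟨ ∑ˡ-cong (flats n) (All.map multiplicity (flats-isFlat2 n)) ⟩
    ∑ˡ (flats n) (λ F → + 24 * g F)
      ≡⟨ ∑ˡ-*ˡ (+ 24) g (flats n) ⟩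
    + 24 * ∑ˡ (flats n) g ∎
    where
    open ≡-Reasoning
    h indicator : Subset n → V n → V n → V n → ℤ
    h F x u v = if does (independent? u v) then (if does (flat x u v ≐? F) then g F else 0ℤ) else 0ℤ
    indicator F x u v = if does (independent? u v) then 𝟙 (does (flat x u v ≐? F)) else 0ℤ
    match : ∀ x u v → (if does (independent? u v) then g (flat x u v) else 0ℤ) ≡ ∑ˡ (flats n) (λ F → h F x u v)
    match x u v with independent? u v
    ... | yes li = sym (∑ˡ-match g resp (flats n) (flats-unique n) (flats-complete (flat-isFlat2 x li)))
    ... | no _   = sym (∑ˡ-ε (flats n))
    multiplicity : {F : Subset n} → IsFlat2 F → ∑³ n (h F) ≡ + 24 * g F
    multiplicity {F} F-flat = begin
      ∑³ n (h F)                 ≡⟨ ∑³-cong n pull-out ⟩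
      ∑³ n (λ x u v → indicator F x u v * g F) ≡⟨ ∑³-*ʳ (g F) (indicator F) ⟩
      ∑³ n (indicator F) * g F   ≡⟨ cong (_* g F) (flat-multiplicity F-flat) ⟩
      + 24 * g F                 ∎
      where
      pull-out : ∀ x u v → h F x u v ≡ indicator F x u v * g F
      pull-out x u v with does (independent? u v) | does (flat x u v ≐? F)
      ... | false | _     = refl
      ... | true  | false = refl
      ... | true  | true  = sym (ℤₚ.*-identityˡ (g F))

  ∑ˡ-𝟙 : {A : Set} (p : A → Bool) (xs : List A) →
    ∑ˡ xs (λ x → 𝟙 (p x)) ≡ + List.length (List.filter (λ x → p x Bool.≟ true) xs)
  ∑ˡ-𝟙 p []       = refl
  ∑ˡ-𝟙 p (x ∷ xs) with p x
  ... | true  = cong (_+_ 1ℤ) (∑ˡ-𝟙 p xs)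
  ... | false = trans (ℤₚ.+-identityˡ _) (∑ˡ-𝟙 p xs)

  ∑³-𝟙-D² : (f : BoolFun n) → ∑³ n (λ x u v → 𝟙 (D² f u v x)) ≡ + 24 * + List.length (oddFlats f)
  ∑³-𝟙-D² {n} f = begin
    ∑³ n (λ x u v → 𝟙 (D² f u v x))
      ≡⟨ ∑³-cong n (𝟙-D² f) ⟩
    ∑³ n (λ x u v → if does (independent? u v) then 𝟙 (sumOn f (flat x u v)) else 0ℤ)
      ≡⟨ double-count (λ A → 𝟙 (sumOn f A)) (cong 𝟙 ∘ sumOn-resp f) ⟩
    + 24 * ∑ˡ (flats n) (λ A → 𝟙 (sumOn f A))
      ≡⟨ cong (_*_ (+ 24)) (∑ˡ-𝟙 (sumOn f) (flats n)) ⟩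
    + 24 * + List.length (oddFlats f) ∎
    where open ≡-Reasoning

  24*∣flats∣ : ∀ n → + 24 * + List.length (flats n) ≡ pow2 n * ((pow2 n - 1ℤ) * (pow2 n - 1ℤ - 1ℤ))
  24*∣flats∣ n = begin
    + 24 * + List.length (flats n)
      ≡⟨ cong (_*_ (+ 24)) (trans (sym (ℤₚ.*-identityʳ (+ List.length (flats n)))) (sym (∑ˡ-const 1ℤ (flats n)))) ⟩
    + 24 * ∑ˡ (flats n) (λ _ → 1ℤ)
      ≡⟨ double-count {n} (λ _ → 1ℤ) (λ _ → refl) ⟨
    ∑³ n (λ x u v → if does (independent? u v) then 1ℤ else 0ℤ)
      ≡⟨ ∑³-independent n ⟩
    pow2 n * ((pow2 n - 1ℤ) * (pow2 n - 1ℤ - 1ℤ)) ∎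
    where open ≡-Reasoning

  ∑³-+ : (g h : V n → V n → V n → ℤ) → ∑³ n (λ x u v → g x u v + h x u v) ≡ ∑³ n g + ∑³ n h
  ∑³-+ {n} g h = begin
    ∑ n (λ v → ∑ n (λ x → ∑ n (λ u → g x u v + h x u v)))
      ≡⟨ ∑-cong n (λ v → ∑-cong n (λ x → ∑ˡ-∙ _ _ (allVecs n))) ⟩
    ∑ n (λ v → ∑ n (λ x → ∑ n (λ u → g x u v) + ∑ n (λ u → h x u v)))
      ≡⟨ ∑-cong n (λ v → ∑ˡ-∙ _ _ (allVecs n)) ⟩
    ∑ n (λ v → ∑ n (λ x → ∑ n (λ u → g x u v)) + ∑ n (λ x → ∑ n (λ u → h x u v)))
      ≡⟨ ∑ˡ-∙ _ _ (allVecs n) ⟩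
    ∑³ n g + ∑³ n h ∎
    where open ≡-Reasoning

  ∑³-const : ∀ n (c : ℤ) → ∑³ n (λ _ _ _ → c) ≡ pow2 n * (pow2 n * (pow2 n * c))
  ∑³-const n c = trans (∑-cong n (λ _ → trans (∑-cong n (λ _ → ∑-const n c)) (∑-const n _))) (∑-const n _)

  sign+𝟙+𝟙 : ∀ b → sign b + (𝟙 b + 𝟙 b) ≡ 1ℤ
  sign+𝟙+𝟙 false = refl
  sign+𝟙+𝟙 true  = refl

  semiBent-∑³-𝟙-D² : Odd n → (f : BoolFun n) → SemiBent n f →
    let T = ∑³ n (λ x u v → 𝟙 (D² f u v x)) in pow2 (suc n) * pow2 n + (T + T) ≡ pow2 n * (pow2 n * (pow2 n * 1ℤ))
  semiBent-∑³-𝟙-D² {n} odd f semiBent = begin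
    pow2 (suc n) * pow2 n + (∑³ n 𝟙D² + ∑³ n 𝟙D²)
      ≡⟨ cong₂ _+_ (∑³-sign-D²-semiBent odd f semiBent) (∑³-+ 𝟙D² 𝟙D²) ⟨
    ∑³ n signD² + ∑³ n (λ x u v → 𝟙D² x u v + 𝟙D² x u v)
      ≡⟨ ∑³-+ signD² _ ⟨
    ∑³ n (λ x u v → signD² x u v + (𝟙D² x u v + 𝟙D² x u v))
      ≡⟨ ∑³-cong n (λ x u v → sign+𝟙+𝟙 (D² f u v x)) ⟩
    ∑³ n (λ _ _ _ → 1ℤ)
      ≡⟨ ∑³-const n 1ℤ ⟩
    pow2 n * (pow2 n * (pow2 n * 1ℤ)) ∎
    where
    open ≡-Reasoning
    signD² 𝟙D² : V n → V n → V n → ℤ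
    signD² x u v = sign (D² f u v x)
    𝟙D² x u v = 𝟙 (D² f u v x)

  six-N : (R N : ℤ) → let P = + 2 * (1ℤ + R) in
    (+ 2 * P) * P + (+ 24 * N + + 24 * N) ≡ P * (P * (P * 1ℤ)) → + 6 * N ≡ (1ℤ + R) * (1ℤ + R) * R
  six-N R N h = ℤₚ.*-cancelˡ-≡ (+ 8) _ _ (trans (isolate R N) (trans (cong (_- _) h) (expand R)))
    where
    isolate : ∀ R N → let P = + 2 * (1ℤ + R) in
      + 8 * (+ 6 * N) ≡ ((+ 2 * P) * P + (+ 24 * N + + 24 * N)) - (+ 2 * P) * P
    isolate = ℤ-solve-∀
    expand : ∀ R → let P = + 2 * (1ℤ + R) in
      P * (P * (P * 1ℤ)) - (+ 2 * P) * P ≡ + 8 * ((1ℤ + R) * (1ℤ + R) * R)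
    expand = ℤ-solve-∀

  six-A : (R A : ℤ) → let P = + 2 * (1ℤ + R) in
    + 24 * A ≡ P * ((P - 1ℤ) * (P - 1ℤ - 1ℤ)) → + 6 * A ≡ (1ℤ + R) * (1ℤ + + 2 * R) * R
  six-A R A h = ℤₚ.*-cancelˡ-≡ (+ 4) _ _ (trans (regroup A) (trans h (expand R)))
    where
    regroup : ∀ A → + 4 * (+ 6 * A) ≡ + 24 * A
    regroup = ℤ-solve-∀
    expand : ∀ R → let P = + 2 * (1ℤ + R) in
      P * ((P - 1ℤ) * (P - 1ℤ - 1ℤ)) ≡ + 4 * ((1ℤ + R) * (1ℤ + + 2 * R) * R)
    expand = ℤ-solve-∀

  counts-in-ℕ : Odd n → (N A : ℕ) →
    pow2 (suc n) * pow2 n + (+ 24 * + N + + 24 * + N) ≡ pow2 n * (pow2 n * (pow2 n * 1ℤ)) →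
    + 24 * + A ≡ pow2 n * ((pow2 n - 1ℤ) * (pow2 n - 1ℤ - 1ℤ)) →
    Σ ℕ λ r → 2 ℕ.^ (n ℕ.∸ 1) ≡ suc r × 6 ℕ.* N ≡ suc r ℕ.* suc r ℕ.* r × 6 ℕ.* A ≡ suc r ℕ.* suc (2 ℕ.* r) ℕ.* r
  counts-in-ℕ (k , refl) N A hN hA = r , q≡1+r , N-identity , A-identity
    where
    r : ℕ
    r = ℕ.pred (2 ℕ.^ (2 ℕ.* k))
    q≡1+r : 2 ℕ.^ (2 ℕ.* k) ≡ suc r
    q≡1+r = sym (ℕₚ.suc-pred (2 ℕ.^ (2 ℕ.* k)) {{ℕₚ.m^n≢0 2 (2 ℕ.* k)}})
    P≡ : pow2 (suc (2 ℕ.* k)) ≡ + 2 * (1ℤ + + r)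
    P≡ = trans (cong (λ m → + (2 ℕ.* m)) q≡1+r) (ℤₚ.pos-* 2 (suc r))
    2P≡ : pow2 (suc (suc (2 ℕ.* k))) ≡ + 2 * (+ 2 * (1ℤ + + r))
    2P≡ = trans (ℤₚ.pos-* 2 (2 ℕ.^ suc (2 ℕ.* k))) (cong (+ 2 *_) P≡)
    N-identity : 6 ℕ.* N ≡ suc r ℕ.* suc r ℕ.* r
    N-identity = ℤₚ.+-injective (begin
      + (6 ℕ.* N)                      ≡⟨ ℤₚ.pos-* 6 N ⟩
      + 6 * + N                        ≡⟨ six-N (+ r) (+ N) (subst₂ (λ p₂ p → p₂ * p + (+ 24 * + N + + 24 * + N) ≡ p * (p * (p * 1ℤ)))
                                                                2P≡ P≡ hN) ⟩
      (1ℤ + + r) * (1ℤ + + r) * + r    ≡⟨ trans (ℤₚ.pos-* (suc r ℕ.* suc r) r) (cong (_* + r) (ℤₚ.pos-* (suc r) (suc r))) ⟨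
      + (suc r ℕ.* suc r ℕ.* r)        ∎)
      where open ≡-Reasoning
    A-identity : 6 ℕ.* A ≡ suc r ℕ.* suc (2 ℕ.* r) ℕ.* r
    A-identity = ℤₚ.+-injective (begin
      + (6 ℕ.* A)                             ≡⟨ ℤₚ.pos-* 6 A ⟩
      + 6 * + A                               ≡⟨ six-A (+ r) (+ A) (subst (λ p → + 24 * + A ≡ p * ((p - 1ℤ) * (p - 1ℤ - 1ℤ))) P≡ hA) ⟩
      (1ℤ + + r) * (1ℤ + + 2 * + r) * + r     ≡⟨ trans (ℤₚ.pos-* (suc r ℕ.* suc (2 ℕ.* r)) r)
                                                    (cong (_* + r) (trans (ℤₚ.pos-* (suc r) (suc (2 ℕ.* r)))
                                                      (cong (λ t → (1ℤ + + r) * (1ℤ + t)) (ℤₚ.pos-* 2 r)))) ⟨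
      + (suc r ℕ.* suc (2 ℕ.* r) ℕ.* r)       ∎)
      where open ≡-Reasoning

  semiBent-flat-counts : Odd n → (f : BoolFun n) → SemiBent n f → Σ ℕ λ r → 2 ℕ.^ (n ℕ.∸ 1) ≡ suc r ×
    6 ℕ.* List.length (oddFlats f) ≡ suc r ℕ.* suc r ℕ.* r × 6 ℕ.* List.length (flats n) ≡ suc r ℕ.* suc (2 ℕ.* r) ℕ.* r
  semiBent-flat-counts {n} odd f semiBent =
    counts-in-ℕ odd (List.length (oddFlats f)) (List.length (flats n)) 24N-identity (24*∣flats∣ n)
    where
    24N-identity : let N = + List.length (oddFlats f) in
      pow2 (suc n) * pow2 n + (+ 24 * N + + 24 * N) ≡ pow2 n * (pow2 n * (pow2 n * 1ℤ))
    24N-identity = subst (λ T → pow2 (suc n) * pow2 n + (T + T) ≡ pow2 n * (pow2 n * (pow2 n * 1ℤ)))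
                         (∑³-𝟙-D² f) (semiBent-∑³-𝟙-D² odd f semiBent)

open import Data.Nat using (_*_; _^_; _∸_)

ratio-formula : ∀ {m r N A} → 2 ^ m ≡ suc r →
  6 * N ≡ suc r * suc r * r → 6 * A ≡ suc r * suc (2 * r) * r → N * (2 ^ suc m ∸ 1) ≡ 2 ^ m * A
ratio-formula {m} {r} {N} {A} q≡1+r N-identity A-identity = begin
  N * (2 ^ suc m ∸ 1)   ≡⟨ cong (λ q → N * (2 * q ∸ 1)) q≡1+r ⟩
  N * (2 * suc r ∸ 1)   ≡⟨ cong (λ t → N * (t ∸ 1)) (ℕₚ.*-suc 2 r) ⟩
  N * suc (2 * r)       ≡⟨ ℕₚ.*-cancelˡ-≡ _ _ 6 (begin
    6 * (N * suc (2 * r))             ≡⟨ ℕₚ.*-assoc 6 N _ ⟨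
    6 * N * suc (2 * r)               ≡⟨ cong (_* suc (2 * r)) N-identity ⟩
    suc r * suc r * r * suc (2 * r)   ≡⟨ regroup (suc r) r ⟩
    suc r * (suc r * suc (2 * r) * r) ≡⟨ cong (suc r *_) A-identity ⟨
    suc r * (6 * A)                   ≡⟨ regroup′ (suc r) A ⟩
    6 * (suc r * A)                   ∎) ⟩
  suc r * A             ≡⟨ cong (_* A) q≡1+r ⟨
  2 ^ m * A             ∎
  where
  open ≡-Reasoning
  regroup : ∀ q r → q * q * r * suc (2 * r) ≡ q * (q * suc (2 * r) * r)
  regroup = ℕ-solve-∀
  regroup′ : ∀ q A → q * (6 * A) ≡ 6 * (q * A)
  regroup′ = ℕ-solve-∀

3N-formula : ∀ k {r N} → 2 ^ (2 * k) ≡ suc r → 6 * N ≡ suc r * suc r * r →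
  3 * N ≡ 2 ^ (2 * suc (2 * k) ∸ 3) * (2 ^ (2 * k) ∸ 1)
-- For n = 1 the exponent 2 * n ∸ 3 is truncated to 0; both sides vanish because N = 0.
3N-formula zero {N = N} refl N-identity with ℕₚ.m*n≡0⇒m≡0 N 6 (trans (ℕₚ.*-comm N 6) N-identity)
... | refl = refl
3N-formula (suc j) {r} {N} q≡1+r N-identity = ℕₚ.*-cancelˡ-≡ _ _ 2 (begin
  2 * (3 * N)                  ≡⟨ ℕₚ.*-assoc 2 3 N ⟨
  6 * N                        ≡⟨ N-identity ⟩
  suc r * suc r * r            ≡⟨ cong (_* r) square ⟨
  2 * 2 ^ e * r                ≡⟨ ℕₚ.*-assoc 2 (2 ^ e) r ⟩
  2 * (2 ^ e * r)              ≡⟨ cong (λ q → 2 * (2 ^ e * (q ∸ 1))) q≡1+r ⟨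
  2 * (2 ^ e * (2 ^ m ∸ 1))    ∎)
  where
  open ≡-Reasoning
  m = 2 * suc j
  e = 2 * suc m ∸ 3
  e+1≡m+m : suc e ≡ m ℕ.+ m
  e+1≡m+m = trans (cong (λ t → suc (t ∸ 3)) (shape j)) (shape′ j)
    where
    shape : ∀ j → 2 * suc (2 * suc j) ≡ 3 ℕ.+ (3 ℕ.+ 4 * j)
    shape = ℕ-solve-∀
    shape′ : ∀ j → suc (3 ℕ.+ 4 * j) ≡ 2 * suc j ℕ.+ 2 * suc j
    shape′ = ℕ-solve-∀
  square : 2 * 2 ^ e ≡ suc r * suc r
  square = begin
    2 ^ suc e            ≡⟨ cong (2 ^_) e+1≡m+m ⟩
    2 ^ (m ℕ.+ m)        ≡⟨ ℕₚ.^-distribˡ-+-* 2 m m ⟩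
    2 ^ m * 2 ^ m        ≡⟨ cong₂ _*_ q≡1+r q≡1+r ⟩
    suc r * suc r        ∎

proposition3p3 : (n : ℕ) → Odd n → (f : BoolFun n) → SemiBent n f →
    Σ ℕ λ N → Σ ℕ λ A → HasCard (InN2 f) N × HasCard (IsFlat2 {n}) A ×
    (3 * N ≡ 2 ^ (2 * n ∸ 3) * (2 ^ (n ∸ 1) ∸ 1)) ×
    (N * (2 ^ n ∸ 1) ≡ 2 ^ (n ∸ 1) * A)
proposition3p3 n odd@(k , refl) f semiBent =
  let N = List.length (oddFlats f)
      A = List.length (flats n)
      r , q≡1+r , N-identity , A-identity = semiBent-flat-counts odd f semiBent
  in N , A , oddFlats-hasCard f , flats-hasCard n ,
     3N-formula k {N = N} q≡1+r N-identity , ratio-formula {m = 2 * k} {N = N} {A = A} q≡1+r N-identity A-identity
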